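{- Let $q$ be a power of a prime number, $m\ge1$, $A=\mathbb{F}_{q}[X]/\langle X^{m}\rangle$, and let $n\ge1$ be odd. Then \[w_{n+2}^{\overline{1}}(A)=\frac{q^{nm+1}-q^{n(m-1)}}{q^{m-1}(q^{2}-1)}.\]
   Context: For a commutative unitary ring $A$ and $(a_1,\dots,a_n)\in A^n$, $M_{n}(a_1,\ldots,a_n):=\begin{pmatrix} a_{n} & -1_{A} \\ 1_{A} & 0_{A}\end{pmatrix}\cdots\begin{pmatrix} a_{1} & -1_{A} \\ 1_{A} & 0_{A}\end{pmatrix}$. For a unit $u$ of $A$, $w_{n}^{u}(A)$ is the number of $(a_1,\dots,a_n)\in A^n$ with $M_n(a_1,\dots,a_n)=\begin{pmatrix} u & 0_A\\ 0_A & u^{ -1}\end{pmatrix}$. Here $\overline{1}$ is the identity of $A$. -}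

module Defs where

open import Level using (0ℓ)
open import Algebra.Bundles using (CommutativeRing)
open import Data.Nat using (ℕ; zero; suc; _∸_; _^_; _≤_; _<?_)
import Data.Nat as ℕ
open import Data.Nat.Primality using (Prime)
open import Data.Fin using (Fin; fromℕ<; toℕ) renaming (_≟_ to _≟ᶠ_)
open import Data.Fin.Properties using ()
open import Data.Vec using (Vec; []; _∷_; lookup)
open import Data.List using (List; []; _∷_; length; filterᵇ; allFin; foldr; concatMap; map)
open import Data.Bool using (Bool; true; _∧_)
open import Data.Product using (∃; _×_; _,_)
open import Relation.Nullary using (¬_; yes; no)
open import Relation.Nullary.Decidable using (⌊_⌋)
open import Relation.Binary.PropositionalEquality using (_≡_)

IsPrimePower : ℕ → Set
IsPrimePower q = ∃ λ p → ∃ λ k → Prime p × 1 ≤ k × q ≡ p ^ k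

Odd : ℕ → Set
Odd n = ∃ λ k → n ≡ suc (2 ℕ.* k)

record FiniteField (q : ℕ) : Set₁ where
  field
    commRing : CommutativeRing 0ℓ 0ℓ
  open CommutativeRing commRing public
  field
    1≉0        : ¬ (1# ≈ 0#)
    inverse    : ∀ x → ¬ (x ≈ 0#) → ∃ λ y → x * y ≈ 1#
    enum       : Fin q → Carrier
    index      : Carrier → Fin q
    enum-index : ∀ x → enum (index x) ≈ x
    index-enum : ∀ i → index (enum i) ≡ i
    index-cong : ∀ {x y} → x ≈ y → index x ≡ index y

module Trunc {q : ℕ} (F : FiniteField q) (m : ℕ) where
  open FiniteField F using (Carrier; _+_; _*_; -_; 0#; 1#; enum; index)

  -- Elements of A = F[X]/⟨X^m⟩, represented by their m coefficients
  -- (coefficient of X^i for i < m).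
  A : Set
  A = Fin m → Carrier

  coef : A → ℕ → Carrier
  coef a i with i <? m
  ... | yes i<m = a (fromℕ< i<m)
  ... | no  _   = 0#

  sumTo : (ℕ → Carrier) → ℕ → Carrier
  sumTo f zero    = f zero
  sumTo f (suc k) = sumTo f k + f (suc k)

  _+A_ : A → A → A
  (a +A b) i = a i + b i

  -A_ : A → A
  (-A a) i = - (a i)

  _*A_ : A → A → A
  (a *A b) i = sumTo (λ j → coef a j * coef b (toℕ i ∸ j)) (toℕ i)

  0A : A
  0A _ = 0#

  1A : A
  1A i with toℕ i
  ... | zero  = 1#
  ... | suc _ = 0#

  record Mat : Set where
    constructor mat
    field
      m11 m12 m21 m22 : A

  _·_ : Mat → Mat → Mat
  mat a b c d · mat e f g h =
    mat ((a *A e) +A (b *A g)) ((a *A f) +A (b *A h))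
        ((c *A e) +A (d *A g)) ((c *A f) +A (d *A h))

  idMat : Mat
  idMat = mat 1A 0A 0A 1A

  E : A → Mat
  E a = mat a (-A 1A) 1A 0A

  -- M_n(a_1,…,a_n) = E(a_n) ⋯ E(a_1)
  Mgo : ∀ {n} → Mat → Vec A n → Mat
  Mgo acc []       = acc
  Mgo acc (a ∷ as) = Mgo (E a · acc) as

  M : ∀ {n} → Vec A n → Mat
  M = Mgo idMat

  eqA : A → A → Bool
  eqA x y = foldr (λ b r → b ∧ r) true (map (λ i → ⌊ index (x i) ≟ᶠ index (y i) ⌋) (allFin m))

  isId : Mat → Bool
  isId (mat a b c d) = eqA a 1A ∧ eqA b 0A ∧ eqA c 0A ∧ eqA d 1A

  allVecs : ∀ {X : Set} → List X → (k : ℕ) → List (Vec X k)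
  allVecs xs zero    = [] ∷ []
  allVecs xs (suc k) = concatMap (λ x → map (x ∷_) (allVecs xs k)) xs

  allA : List A
  allA = map (λ v i → enum (lookup v i)) (allVecs (allFin q) m)

  w1 : ℕ → ℕ
  w1 n = length (filterᵇ (λ as → isId (M as)) (allVecs allA n))

module Submission where

-- Write K(a₁,…,aₙ) for the top left entry of M(a₁,…,aₙ), the continuant. Since
-- det M = 1, the product M(a₁,…,aₙ,b,c) = E(c) E(b) M(a₁,…,aₙ) is the identity iff
-- K(a₁,…,aₙ) = −1 and b, c take the unique values read off from M(a₁,…,aₙ); so
-- w_{n+2} counts the words of length n with continuant −1. For odd n, multiplying the
-- letters alternately by a unit u and by u⁻¹ multiplies K by u, hence every unit of
-- A = F[X]/⟨X^m⟩ is the continuant of exactly w_{n+2} words. Now count the words whose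
-- continuant is a unit in two ways: by fibres this gives q^(m−1)(q−1)·w_{n+2}, and
-- reducing modulo X (an element of A is a unit iff its constant term is nonzero, and
-- reduction Aⁿ → Fⁿ has fibres of size q^((m−1)n)) gives q^((m−1)n)·N(n), where N(n)
-- counts the words over F with nonzero continuant. Finally the number Z(n) of words
-- over F with continuant 0 satisfies Z(n+1) = N(n) = qⁿ − Z(n) (the continuant is
-- affine in the new letter, and two consecutive continuants never both vanish), so
-- (q+1)·Z(n) = qⁿ + 1 for odd n.

open import Defs

open import Level using (Level; 0ℓ)
open import Algebra.Bundles using (CommutativeRing; RawRing)
open import Data.Nat as ℕ using (ℕ; zero; suc)
open import Data.Product using (_×_; _,_)
open import Relation.Binary.PropositionalEquality as ≡ using (_≡_)
open import Algebra.Morphism.Structures using (IsRingHomomorphism)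
open import Algebra.Structures using (IsCommutativeRing)
import Data.Vec.Relation.Binary.Pointwise.Inductive as Pointwise

-- A ring solver for an arbitrary commutative ring, with coefficients
-- (a , b) : ℕ × ℕ standing for the integer a − b.
module CommutativeRingSolver {c ℓ : Level} (R : CommutativeRing c ℓ) where
  open CommutativeRing R hiding (zero)
  open import Data.Maybe using (Maybe; just; nothing)
  open import Relation.Nullary using (yes; no)
  open import Relation.Binary.Reasoning.Setoid setoid
  open import Algebra.Solver.Ring.AlmostCommutativeRing
  open import Algebra.Properties.Semiring.Mult semiring using (×1-homo-*; ×-homo-+) renaming (_×_ to _×ʳ_)
  open import Algebra.Properties.Ring ring using (-‿distribˡ-*; x[y-z]≈xy-xz)
  open import Algebra.Properties.AbelianGroup +-abelianGroup using (⁻¹-anti-homo‿-; ⁻¹-∙-comm)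
  open import Algebra.Properties.CommutativeSemigroup +-commutativeSemigroup using (interchange)
  open import Algebra.Properties.Group +-group using (ε⁻¹≈ε)

  private
    ι : ℕ → Carrier
    ι n = n ×ʳ 1#

    -‿+-interchange : ∀ x y z w → (x - y) + (z - w) ≈ (x + z) - (y + w)
    -‿+-interchange x y z w = trans (interchange x (- y) z (- w)) (+-congˡ (⁻¹-∙-comm y w))

    -‿*-expand : ∀ x y z w → (x - y) * (z - w) ≈ (x * z + y * w) - (x * w + y * z)
    -‿*-expand x y z w = begin
      (x - y) * (z - w)                  ≈⟨ x[y-z]≈xy-xz (x - y) z w ⟩
      (x - y) * z - (x - y) * w          ≈⟨ +-cong (distribʳ-sub z) (-‿cong (distribʳ-sub w)) ⟩
      (x * z - y * z) - (x * w - y * w)  ≈⟨ +-congˡ (⁻¹-anti-homo‿- (x * w) (y * w)) ⟩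
      (x * z - y * z) + (y * w - x * w)  ≈⟨ -‿+-interchange (x * z) (y * z) (y * w) (x * w) ⟩
      (x * z + y * w) - (y * z + x * w)  ≈⟨ +-congˡ (-‿cong (+-comm (y * z) (x * w))) ⟩
      (x * z + y * w) - (x * w + y * z)  ∎
      where
      distribʳ-sub : ∀ t → (x - y) * t ≈ x * t - y * t
      distribʳ-sub t = trans (distribʳ t x (- y)) (+-congˡ (sym (-‿distribˡ-* y t)))

    -‿cross : ∀ x y z w → x + w ≈ z + y → x - y ≈ z - w
    -‿cross x y z w e = begin
      x - y                 ≈⟨ sym (+-identityʳ _) ⟩
      (x - y) + 0#          ≈⟨ +-congˡ (sym (-‿inverseʳ w)) ⟩
      (x - y) + (w - w)     ≈⟨ -‿+-interchange x y w w ⟩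
      (x + w) - (y + w)     ≈⟨ +-cong e (-‿cong (+-comm y w)) ⟩
      (z + y) - (w + y)     ≈⟨ -‿+-interchange z w y y ⟨
      (z - w) + (y - y)     ≈⟨ +-congˡ (-‿inverseʳ y) ⟩
      (z - w) + 0#          ≈⟨ +-identityʳ _ ⟩
      z - w                 ∎

    -- The constants 0, 1 and −1 are interpreted as 0#, 1# and - 1# on the
    -- nose, so that they match the constants of a goal definitionally.
    ⟦_⟧ᶜ : ℕ × ℕ → Carrier
    ⟦ 0 , 0 ⟧ᶜ = 0#
    ⟦ 1 , 0 ⟧ᶜ = 1#
    ⟦ 0 , 1 ⟧ᶜ = - 1#
    ⟦ a , b ⟧ᶜ = ι a - ι b

    ⟦⟧ᶜ-correct : ∀ a b → ⟦ a , b ⟧ᶜ ≈ ι a - ι b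
    ⟦⟧ᶜ-correct 0 0 = sym (-‿inverseʳ 0#)
    ⟦⟧ᶜ-correct 1 0 = sym (trans (+-cong (+-identityʳ 1#) ε⁻¹≈ε) (+-identityʳ 1#))
    ⟦⟧ᶜ-correct 0 1 = sym (trans (+-congˡ (-‿cong (+-identityʳ 1#))) (+-identityˡ _))
    ⟦⟧ᶜ-correct 0 (suc (suc b)) = refl
    ⟦⟧ᶜ-correct 1 (suc b) = refl
    ⟦⟧ᶜ-correct (suc (suc a)) b = refl

    cancel : ℕ → ℕ → ℕ × ℕ
    cancel zero    b       = zero , b
    cancel (suc a) zero    = suc a , zero
    cancel (suc a) (suc b) = cancel a b

    cancel-correct : ∀ a b → ⟦ cancel a b ⟧ᶜ ≈ ι a - ι b
    cancel-correct zero b = ⟦⟧ᶜ-correct zero b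
    cancel-correct (suc a) zero = ⟦⟧ᶜ-correct (suc a) zero
    cancel-correct (suc a) (suc b) = begin
      ⟦ cancel a b ⟧ᶜ          ≈⟨ cancel-correct a b ⟩
      ι a - ι b                ≈⟨ +-identityˡ _ ⟨
      0# + (ι a - ι b)         ≈⟨ +-congʳ (-‿inverseʳ 1#) ⟨
      (1# - 1#) + (ι a - ι b)  ≈⟨ -‿+-interchange 1# 1# (ι a) (ι b) ⟩
      ι (suc a) - ι (suc b)    ∎

    Coeff : RawRing 0ℓ 0ℓ
    Coeff = record
      { Carrier = ℕ × ℕ
      ; _≈_ = _≡_
      ; _+_ = λ { (a , b) (c , d) → cancel (a ℕ.+ c) (b ℕ.+ d) }
      ; _*_ = λ { (a , b) (c , d) → cancel (a ℕ.* c ℕ.+ b ℕ.* d) (a ℕ.* d ℕ.+ b ℕ.* c) }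
      ; -_  = λ { (a , b) → b , a }
      ; 0#  = 0 , 0
      ; 1#  = 1 , 0
      }

    ι-+ : ∀ a b → ι (a ℕ.+ b) ≈ ι a + ι b
    ι-+ = ×-homo-+ 1#

    ι-lin : ∀ a b c d → ι (a ℕ.* b ℕ.+ c ℕ.* d) ≈ ι a * ι b + ι c * ι d
    ι-lin a b c d = trans (ι-+ (a ℕ.* b) (c ℕ.* d)) (+-cong (×1-homo-* a b) (×1-homo-* c d))

    ⟦⟧ᶜ-homo : Coeff -Raw-AlmostCommutative⟶ fromCommutativeRing R
    ⟦⟧ᶜ-homo = record
      { ⟦_⟧ = ⟦_⟧ᶜ
      ; +-homo = λ { (a , b) (c , d) → begin
          ⟦ cancel (a ℕ.+ c) (b ℕ.+ d) ⟧ᶜ  ≈⟨ cancel-correct (a ℕ.+ c) (b ℕ.+ d) ⟩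
          ι (a ℕ.+ c) - ι (b ℕ.+ d)        ≈⟨ +-cong (ι-+ a c) (-‿cong (ι-+ b d)) ⟩
          (ι a + ι c) - (ι b + ι d)        ≈⟨ -‿+-interchange (ι a) (ι b) (ι c) (ι d) ⟨
          (ι a - ι b) + (ι c - ι d)        ≈⟨ +-cong (⟦⟧ᶜ-correct a b) (⟦⟧ᶜ-correct c d) ⟨
          ⟦ a , b ⟧ᶜ + ⟦ c , d ⟧ᶜ          ∎ }
      ; *-homo = λ { (a , b) (c , d) → begin
          ⟦ cancel (a ℕ.* c ℕ.+ b ℕ.* d) (a ℕ.* d ℕ.+ b ℕ.* c) ⟧ᶜ
            ≈⟨ cancel-correct (a ℕ.* c ℕ.+ b ℕ.* d) (a ℕ.* d ℕ.+ b ℕ.* c) ⟩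
          ι (a ℕ.* c ℕ.+ b ℕ.* d) - ι (a ℕ.* d ℕ.+ b ℕ.* c)
            ≈⟨ +-cong (ι-lin a c b d) (-‿cong (ι-lin a d b c)) ⟩
          (ι a * ι c + ι b * ι d) - (ι a * ι d + ι b * ι c)
            ≈⟨ -‿*-expand (ι a) (ι b) (ι c) (ι d) ⟨
          (ι a - ι b) * (ι c - ι d)
            ≈⟨ *-cong (⟦⟧ᶜ-correct a b) (⟦⟧ᶜ-correct c d) ⟨
          ⟦ a , b ⟧ᶜ * ⟦ c , d ⟧ᶜ ∎ }
      ; -‿homo = λ { (a , b) → begin
          ⟦ b , a ⟧ᶜ      ≈⟨ ⟦⟧ᶜ-correct b a ⟩
          ι b - ι a       ≈⟨ ⁻¹-anti-homo‿- (ι a) (ι b) ⟨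
          - (ι a - ι b)   ≈⟨ -‿cong (⟦⟧ᶜ-correct a b) ⟨
          - ⟦ a , b ⟧ᶜ    ∎ }
      ; 0-homo = refl
      ; 1-homo = refl
      }

    ⟦⟧ᶜ-equal? : ∀ x y → Maybe (⟦ x ⟧ᶜ ≈ ⟦ y ⟧ᶜ)
    ⟦⟧ᶜ-equal? (a , b) (c , d) with a ℕ.+ d ℕ.≟ c ℕ.+ b
    ... | no _  = nothing
    ... | yes e = just (begin
      ⟦ a , b ⟧ᶜ  ≈⟨ ⟦⟧ᶜ-correct a b ⟩
      ι a - ι b   ≈⟨ -‿cross (ι a) (ι b) (ι c) (ι d)
                       (trans (sym (ι-+ a d)) (trans (reflexive (≡.cong ι e)) (ι-+ c b))) ⟩
      ι c - ι d   ≈⟨ ⟦⟧ᶜ-correct c d ⟨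
      ⟦ c , d ⟧ᶜ  ∎)

  open import Algebra.Solver.Ring Coeff (fromCommutativeRing R) ⟦⟧ᶜ-homo ⟦⟧ᶜ-equal? public

  :0 :1 : ∀ {n} → Polynomial n
  :0 = con (0 , 0)
  :1 = con (1 , 0)

module Sums where
  open import Data.Nat using (_+_; _*_; _^_)
  open import Data.Nat.Properties using (+-assoc; +-identityʳ; *-identityʳ; *-zeroʳ; *-comm; *-distribˡ-+; +-commutativeSemigroup)
  open import Algebra.Properties.CommutativeSemigroup +-commutativeSemigroup using (interchange)
  open import Data.Bool using (Bool; true; false; not; _∧_)
  open import Data.List using (List; []; _∷_; length; filterᵇ; map; concatMap; _++_)
  open import Data.Vec using (Vec; []; _∷_) renaming (_++_ to _++ᵛ_)
  open ≡ using (refl; cong; cong₂; sym; trans)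

  [_] : Bool → ℕ
  [ true  ] = 1
  [ false ] = 0

  [∧] : ∀ x y → [ x ∧ y ] ≡ [ x ] * [ y ]
  [∧] true  y = sym (+-identityʳ [ y ])
  [∧] false y = refl

  [b]+[not-b] : ∀ b → [ b ] + [ not b ] ≡ 1
  [b]+[not-b] true  = refl
  [b]+[not-b] false = refl

  ∑ : {X : Set} → List X → (X → ℕ) → ℕ
  ∑ []       h = 0
  ∑ (x ∷ xs) h = h x + ∑ xs h

  length-filterᵇ : {X : Set} (P : X → Bool) (xs : List X) → length (filterᵇ P xs) ≡ ∑ xs (λ x → [ P x ])
  length-filterᵇ P [] = refl
  length-filterᵇ P (x ∷ xs) with P x
  ... | true  = cong suc (length-filterᵇ P xs)
  ... | false = length-filterᵇ P xs

  ∑-cong : {X : Set} (xs : List X) {h g : X → ℕ} → (∀ x → h x ≡ g x) → ∑ xs h ≡ ∑ xs g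
  ∑-cong []       e = refl
  ∑-cong (x ∷ xs) e = cong₂ _+_ (e x) (∑-cong xs e)

  ∑-zero : {X : Set} (xs : List X) → ∑ xs (λ _ → 0) ≡ 0
  ∑-zero []       = refl
  ∑-zero (x ∷ xs) = ∑-zero xs

  ∑-const : {X : Set} (xs : List X) (c : ℕ) → ∑ xs (λ _ → c) ≡ length xs * c
  ∑-const []       c = refl
  ∑-const (x ∷ xs) c = cong (c +_) (∑-const xs c)

  ∑-+ : {X : Set} (xs : List X) (h g : X → ℕ) → ∑ xs (λ x → h x + g x) ≡ ∑ xs h + ∑ xs g
  ∑-+ []       h g = refl
  ∑-+ (x ∷ xs) h g = trans (cong (h x + g x +_) (∑-+ xs h g)) (interchange (h x) (g x) (∑ xs h) (∑ xs g))

  ∑-*ˡ : {X : Set} (xs : List X) (c : ℕ) (h : X → ℕ) → ∑ xs (λ x → c * h x) ≡ c * ∑ xs h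
  ∑-*ˡ []       c h = sym (*-zeroʳ c)
  ∑-*ˡ (x ∷ xs) c h = trans (cong (c * h x +_) (∑-*ˡ xs c h)) (sym (*-distribˡ-+ c (h x) (∑ xs h)))

  ∑-*ʳ : {X : Set} (xs : List X) (c : ℕ) (h : X → ℕ) → ∑ xs (λ x → h x * c) ≡ ∑ xs h * c
  ∑-*ʳ xs c h = trans (∑-cong xs (λ x → *-comm (h x) c)) (trans (∑-*ˡ xs c h) (*-comm c (∑ xs h)))

  ∑-map : {X Y : Set} (f : X → Y) (xs : List X) (h : Y → ℕ) → ∑ (map f xs) h ≡ ∑ xs (λ x → h (f x))
  ∑-map f []       h = refl
  ∑-map f (x ∷ xs) h = cong (h (f x) +_) (∑-map f xs h)

  ∑-++ : {X : Set} (xs ys : List X) (h : X → ℕ) → ∑ (xs ++ ys) h ≡ ∑ xs h + ∑ ys h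
  ∑-++ []       ys h = refl
  ∑-++ (x ∷ xs) ys h = trans (cong (h x +_) (∑-++ xs ys h)) (sym (+-assoc (h x) (∑ xs h) (∑ ys h)))

  ∑-concatMap : {X Y : Set} (f : X → List Y) (xs : List X) (h : Y → ℕ) →
    ∑ (concatMap f xs) h ≡ ∑ xs (λ x → ∑ (f x) h)
  ∑-concatMap f []       h = refl
  ∑-concatMap f (x ∷ xs) h = trans (∑-++ (f x) (concatMap f xs) h) (cong (∑ (f x) h +_) (∑-concatMap f xs h))

  ∑-comm : {X Y : Set} (xs : List X) (ys : List Y) (h : X → Y → ℕ) →
    ∑ xs (λ x → ∑ ys (h x)) ≡ ∑ ys (λ y → ∑ xs (λ x → h x y))
  ∑-comm []       ys h = sym (∑-zero ys)
  ∑-comm (x ∷ xs) ys h = trans (cong (∑ ys (h x) +_) (∑-comm xs ys h)) (sym (∑-+ ys (h x) (λ y → ∑ xs (λ x → h x y))))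

  vectors : {X : Set} → List X → (k : ℕ) → List (Vec X k)
  vectors xs zero    = [] ∷ []
  vectors xs (suc k) = concatMap (λ x → map (x ∷_) (vectors xs k)) xs

  ∑-vectors-suc : {X : Set} (xs : List X) (k : ℕ) (h : Vec X (suc k) → ℕ) →
    ∑ (vectors xs (suc k)) h ≡ ∑ xs (λ x → ∑ (vectors xs k) (λ v → h (x ∷ v)))
  ∑-vectors-suc xs k h = trans (∑-concatMap _ xs h) (∑-cong xs (λ x → ∑-map (x ∷_) (vectors xs k) h))

  length-vectors : {X : Set} (xs : List X) (k : ℕ) → length (vectors xs k) ≡ length xs ^ k
  length-vectors xs zero    = refl
  length-vectors xs (suc k) = begin
    length (vectors xs (suc k))
      ≡⟨ trans (∑-const (vectors xs (suc k)) 1) (*-identityʳ _) ⟨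
    ∑ (vectors xs (suc k)) (λ _ → 1)
      ≡⟨ ∑-vectors-suc xs k (λ _ → 1) ⟩
    ∑ xs (λ _ → ∑ (vectors xs k) (λ _ → 1))
      ≡⟨ ∑-cong xs (λ _ → trans (∑-const (vectors xs k) 1) (*-identityʳ _)) ⟩
    ∑ xs (λ _ → length (vectors xs k))
      ≡⟨ ∑-cong xs (λ _ → length-vectors xs k) ⟩
    ∑ xs (λ _ → length xs ^ k)
      ≡⟨ ∑-const xs (length xs ^ k) ⟩
    length xs * length xs ^ k ∎
    where open ≡.≡-Reasoning

  ∑-vectors-+ : {X : Set} (xs : List X) (k l : ℕ) (h : Vec X (k + l) → ℕ) →
    ∑ (vectors xs (k + l)) h ≡ ∑ (vectors xs k) (λ u → ∑ (vectors xs l) (λ w → h (u ++ᵛ w)))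
  ∑-vectors-+ xs zero    l h = sym (+-identityʳ _)
  ∑-vectors-+ xs (suc k) l h = trans (∑-vectors-suc xs (k + l) h)
    (trans (∑-cong xs (λ x → ∑-vectors-+ xs k l (λ v → h (x ∷ v)))) (sym (∑-vectors-suc xs k _)))

  ∑-vectors-2 : {X : Set} (xs : List X) (h : Vec X 2 → ℕ) → ∑ (vectors xs 2) h ≡ ∑ xs (λ b → ∑ xs (λ c → h (b ∷ c ∷ [])))
  ∑-vectors-2 xs h = trans (∑-vectors-suc xs 1 h)
    (∑-cong xs (λ b → trans (∑-vectors-suc xs 0 _) (∑-cong xs (λ c → +-identityʳ _))))

module Enumerations where
  open Sums
  open import Data.Nat using (_*_)
  open import Data.Nat.Properties using (*-identityˡ; *-identityʳ; *-comm)
  open import Data.Bool using (_∧_)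
  open import Data.List using (List; []; _∷_; map; allFin; tabulate)
  open import Data.List.Properties using (map-tabulate)
  open import Data.Vec using (Vec; []; _∷_)
  open import Data.Fin using (Fin) renaming (zero to fzero; suc to fsuc)
  import Data.Fin.Properties as Fin
  open import Relation.Binary.Bundles using (Setoid; DecSetoid)
  open import Relation.Nullary using (Dec; does; yes; no)
  open import Relation.Nullary.Decidable using (does-⇔; map′)
  open import Function using (_⇔_; mk⇔; id)
  open import Data.Empty using (⊥-elim)
  open ≡.≡-Reasoning

  record Enumeration (S : DecSetoid 0ℓ 0ℓ) : Set where
    open DecSetoid S
    field
      elements        : List Carrier
      elements-unique : ∀ t → ∑ elements (λ x → [ does (x ≟ t) ]) ≡ 1

  module EnumerationProperties {S : DecSetoid 0ℓ 0ℓ} (E : Enumeration S) where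
    open DecSetoid S
    open Enumeration E

    Respects≈ : (Carrier → ℕ) → Set
    Respects≈ h = ∀ {x y} → x ≈ y → h x ≡ h y

    ∑-select : ∀ t (h : Carrier → ℕ) → Respects≈ h → ∑ elements (λ x → [ does (t ≟ x) ] * h x) ≡ h t
    ∑-select t h resp = begin
      ∑ elements (λ x → [ does (t ≟ x) ] * h x)  ≡⟨ ∑-cong elements select ⟩
      ∑ elements (λ x → [ does (x ≟ t) ] * h t)  ≡⟨ ∑-*ʳ elements (h t) _ ⟩
      ∑ elements (λ x → [ does (x ≟ t) ]) * h t  ≡⟨ ≡.cong (_* h t) (elements-unique t) ⟩
      1 * h t                                    ≡⟨ *-identityˡ (h t) ⟩
      h t                                        ∎
      where
      select : ∀ x → [ does (t ≟ x) ] * h x ≡ [ does (x ≟ t) ] * h t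
      select x with t ≟ x | x ≟ t
      ... | yes t≈x | yes _   = ≡.cong (λ n → n ℕ.+ 0) (resp (sym t≈x))
      ... | no  _   | no  _   = ≡.refl
      ... | yes t≈x | no  x≉t = ⊥-elim (x≉t (sym t≈x))
      ... | no  t≉x | yes x≈t = ⊥-elim (t≉x (sym x≈t))

    ∑-∑-unique : ∀ s t b → ∑ elements (λ x → ∑ elements (λ y → [ does (x ≟ s) ∧ (does (y ≟ t) ∧ b) ])) ≡ [ b ]
    ∑-∑-unique s t b = begin
      ∑ elements (λ x → ∑ elements (λ y → [ does (x ≟ s) ∧ (does (y ≟ t) ∧ b) ]))
        ≡⟨ ∑-cong elements (λ x → ∑-cong elements (λ y → ≡.trans ([∧] (does (x ≟ s)) _) (≡.cong ([ does (x ≟ s) ] *_) ([∧] (does (y ≟ t)) b)))) ⟩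
      ∑ elements (λ x → ∑ elements (λ y → [ does (x ≟ s) ] * ([ does (y ≟ t) ] * [ b ])))
        ≡⟨ ∑-cong elements (λ x → ∑-*ˡ elements [ does (x ≟ s) ] _) ⟩
      ∑ elements (λ x → [ does (x ≟ s) ] * ∑ elements (λ y → [ does (y ≟ t) ] * [ b ]))
        ≡⟨ ∑-cong elements (λ x → ≡.cong ([ does (x ≟ s) ] *_) (≡.trans (∑-*ʳ elements [ b ] _) (≡.cong (_* [ b ]) (elements-unique t)))) ⟩
      ∑ elements (λ x → [ does (x ≟ s) ] * (1 * [ b ]))
        ≡⟨ ∑-*ʳ elements (1 * [ b ]) _ ⟩
      ∑ elements (λ x → [ does (x ≟ s) ]) * (1 * [ b ])
        ≡⟨ ≡.cong (_* (1 * [ b ])) (elements-unique s) ⟩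
      1 * (1 * [ b ])
        ≡⟨ ≡.trans (*-identityˡ _) (*-identityˡ _) ⟩
      [ b ] ∎

    ∑-fibres : {X : Set} (L : List X) (K : X → Carrier) (h : Carrier → ℕ) → Respects≈ h →
      ∑ L (λ x → h (K x)) ≡ ∑ elements (λ t → h t * ∑ L (λ x → [ does (K x ≟ t) ]))
    ∑-fibres L K h resp = begin
      ∑ L (λ x → h (K x))
        ≡⟨ ∑-cong L (λ x → ≡.sym (∑-select (K x) h resp)) ⟩
      ∑ L (λ x → ∑ elements (λ t → [ does (K x ≟ t) ] * h t))
        ≡⟨ ∑-comm L elements _ ⟩
      ∑ elements (λ t → ∑ L (λ x → [ does (K x ≟ t) ] * h t))
        ≡⟨ ∑-cong elements (λ t → ∑-*ʳ L (h t) _) ⟩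
      ∑ elements (λ t → ∑ L (λ x → [ does (K x ≟ t) ]) * h t)
        ≡⟨ ∑-cong elements (λ t → *-comm _ (h t)) ⟩
      ∑ elements (λ t → h t * ∑ L (λ x → [ does (K x ≟ t) ])) ∎

    ∑-bijection : (σ τ : Carrier → Carrier) →
      (∀ {x y} → x ≈ y → σ x ≈ σ y) → (∀ {x y} → x ≈ y → τ x ≈ τ y) →
      (∀ x → σ (τ x) ≈ x) → (∀ x → τ (σ x) ≈ x) →
      (h : Carrier → ℕ) → Respects≈ h → ∑ elements (λ x → h (σ x)) ≡ ∑ elements h
    ∑-bijection σ τ σ-cong τ-cong στ τσ h resp = begin
      ∑ elements (λ x → h (σ x))
        ≡⟨ ∑-fibres elements σ h resp ⟩
      ∑ elements (λ t → h t * ∑ elements (λ x → [ does (σ x ≟ t) ]))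
        ≡⟨ ∑-cong elements (λ t → ≡.cong (h t *_) (fibre-size t)) ⟩
      ∑ elements (λ t → h t * 1)
        ≡⟨ ∑-cong elements (λ t → *-identityʳ (h t)) ⟩
      ∑ elements h ∎
      where
      fibre-size : ∀ t → ∑ elements (λ x → [ does (σ x ≟ t) ]) ≡ 1
      fibre-size t = ≡.trans (∑-cong elements (λ x → ≡.cong [_] (does-⇔ σx≈t⇔x≈τt (σ x ≟ t) (x ≟ τ t))))
                           (elements-unique (τ t))
        where
        σx≈t⇔x≈τt : ∀ {x} → σ x ≈ t ⇔ x ≈ τ t
        σx≈t⇔x≈τt {x} = mk⇔ (λ e → trans (sym (τσ x)) (τ-cong e)) (λ e → trans (σ-cong e) (στ t))

  finEnumeration : ∀ n → Enumeration (Fin.≡-decSetoid n)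
  finEnumeration n = record { elements = allFin n ; elements-unique = unique n }
    where
    unique : ∀ n (t : Fin n) → ∑ (allFin n) (λ i → [ does (i Fin.≟ t) ]) ≡ 1
    unique (suc n) t = ≡.trans (≡.cong ([ does (fzero Fin.≟ t) ] ℕ.+_) (∑-suc t)) (split t)
      where
      ∑-suc : ∀ t → ∑ (tabulate fsuc) (λ i → [ does (i Fin.≟ t) ]) ≡ ∑ (allFin n) (λ i → [ does (fsuc i Fin.≟ t) ])
      ∑-suc t = ≡.trans (≡.cong (λ l → ∑ l (λ i → [ does (i Fin.≟ t) ])) (≡.sym (map-tabulate id fsuc)))
                        (∑-map fsuc (allFin n) (λ i → [ does (i Fin.≟ t) ]))
      split : ∀ t → [ does (fzero Fin.≟ t) ] ℕ.+ ∑ (allFin n) (λ i → [ does (fsuc i Fin.≟ t) ]) ≡ 1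
      split fzero    = ≡.cong suc (∑-zero (allFin n))
      split (fsuc t) = unique n t

  vecDecSetoid : DecSetoid 0ℓ 0ℓ → ℕ → DecSetoid 0ℓ 0ℓ
  vecDecSetoid S n = record { isDecEquivalence = Pointwise.isDecEquivalence (DecSetoid.isDecEquivalence S) n }

  vecEnumeration : {S : DecSetoid 0ℓ 0ℓ} → Enumeration S → ∀ n → Enumeration (vecDecSetoid S n)
  vecEnumeration {S} E n = record { elements = vectors elements n ; elements-unique = unique n }
    where
    open DecSetoid S using (Carrier; _≈_; _≟_)
    open Enumeration E
    _≋?_ : ∀ {n} (v w : Vec Carrier n) → Dec (Pointwise.Pointwise _≈_ v w)
    _≋?_ = Pointwise.decidable _≟_

    unique : ∀ n t → ∑ (vectors elements n) (λ v → [ does (v ≋? t) ]) ≡ 1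
    unique zero    []       = ≡.refl
    unique (suc n) (t ∷ ts) = begin
      ∑ (vectors elements (suc n)) (λ v → [ does (v ≋? (t ∷ ts)) ])
        ≡⟨ ∑-vectors-suc elements n _ ⟩
      ∑ elements (λ x → ∑ (vectors elements n) (λ v → [ does (x ≟ t) ∧ does (v ≋? ts) ]))
        ≡⟨ ∑-cong elements (λ x → ∑-cong (vectors elements n) (λ v → [∧] (does (x ≟ t)) _)) ⟩
      ∑ elements (λ x → ∑ (vectors elements n) (λ v → [ does (x ≟ t) ] * [ does (v ≋? ts) ]))
        ≡⟨ ∑-cong elements (λ x → ∑-*ˡ (vectors elements n) [ does (x ≟ t) ] _) ⟩
      ∑ elements (λ x → [ does (x ≟ t) ] * ∑ (vectors elements n) (λ v → [ does (v ≋? ts) ]))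
        ≡⟨ ∑-cong elements (λ x → ≡.cong ([ does (x ≟ t) ] *_) (unique n ts)) ⟩
      ∑ elements (λ x → [ does (x ≟ t) ] * 1)
        ≡⟨ ∑-cong elements (λ x → *-identityʳ _) ⟩
      ∑ elements (λ x → [ does (x ≟ t) ])
        ≡⟨ elements-unique t ⟩
      1 ∎

  module EnumerationViaFin (S : Setoid 0ℓ 0ℓ) {n : ℕ} (enum : Fin n → Setoid.Carrier S) (index : Setoid.Carrier S → Fin n)
    (enum-index : ∀ x → Setoid._≈_ S (enum (index x)) x) (index-enum : ∀ i → index (enum i) ≡ i)
    (index-cong : ∀ {x y} → Setoid._≈_ S x y → index x ≡ index y) where
    open Setoid S

    index-injective : ∀ {x y} → index x ≡ index y → x ≈ y
    index-injective {x} {y} e = trans (sym (enum-index x)) (trans (reflexive (≡.cong enum e)) (enum-index y))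

    decSetoid : DecSetoid 0ℓ 0ℓ
    decSetoid = record
      { isDecEquivalence = record
        { isEquivalence = isEquivalence
        ; _≟_ = λ x y → map′ index-injective index-cong (index x Fin.≟ index y) } }

    enumeration : Enumeration decSetoid
    enumeration = record { elements = map enum (allFin n) ; elements-unique = unique }
      where
      open DecSetoid decSetoid using (_≟_)
      unique : ∀ t → ∑ (map enum (allFin n)) (λ x → [ does (x ≟ t) ]) ≡ 1
      unique t = begin
        ∑ (map enum (allFin n)) (λ x → [ does (x ≟ t) ])
          ≡⟨ ∑-map enum (allFin n) _ ⟩
        ∑ (allFin n) (λ i → [ does (enum i ≟ t) ])
          ≡⟨ ∑-cong (allFin n) (λ i → ≡.cong [_] (does-⇔ (enum≈⇔ i) (enum i ≟ t) (i Fin.≟ index t))) ⟩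
        ∑ (allFin n) (λ i → [ does (i Fin.≟ index t) ])
          ≡⟨ Enumeration.elements-unique (finEnumeration n) (index t) ⟩
        1 ∎
        where
        enum≈⇔ : ∀ i → enum i ≈ t ⇔ i ≡ index t
        enum≈⇔ i = mk⇔ (λ e → ≡.trans (≡.sym (index-enum i)) (index-cong e))
                       (λ e → trans (reflexive (≡.cong enum e)) (enum-index t))

-- Mat, _·_, E, Mgo and M are Trunc's definitions over an arbitrary commutative
-- ring, so that over the truncated polynomial ring they agree definitionally.
module Matrix (R : CommutativeRing 0ℓ 0ℓ) where
  import Data.Nat.Properties as ℕP
  open CommutativeRing R hiding (zero)
  open CommutativeRingSolver R
  open import Data.Vec using (Vec; []; _∷_; _++_)
  open import Relation.Binary.Bundles using (Setoid)
  import Relation.Binary.Reasoning.Setoid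
  open import Function using (_⇔_; mk⇔)
  open import Data.Vec.Relation.Binary.Pointwise.Inductive using (Pointwise; []; _∷_)

  record Mat : Set where
    constructor mat
    field
      m11 m12 m21 m22 : Carrier
  open Mat public

  infixl 7 _·_
  _·_ : Mat → Mat → Mat
  mat a b c d · mat e f g h =
    mat ((a * e) + (b * g)) ((a * f) + (b * h))
        ((c * e) + (d * g)) ((c * f) + (d * h))

  idMat : Mat
  idMat = mat 1# 0# 0# 1#

  diag : Carrier → Carrier → Mat
  diag s t = mat s 0# 0# t

  E : Carrier → Mat
  E a = mat a (- 1#) 1# 0#

  Mgo : ∀ {n} → Mat → Vec Carrier n → Mat
  Mgo acc []       = acc
  Mgo acc (a ∷ as) = Mgo (E a · acc) as

  M : ∀ {n} → Vec Carrier n → Mat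
  M = Mgo idMat

  K : ∀ {n} → Vec Carrier n → Carrier
  K as = m11 (M as)

  det : Mat → Carrier
  det (mat a b c d) = a * d - b * c

  infix 4 _≈M_
  record _≈M_ (X Y : Mat) : Set where
    constructor meq
    field
      e11 : m11 X ≈ m11 Y
      e12 : m12 X ≈ m12 Y
      e21 : m21 X ≈ m21 Y
      e22 : m22 X ≈ m22 Y

  matSetoid : Setoid 0ℓ 0ℓ
  matSetoid = record
    { Carrier = Mat
    ; _≈_ = _≈M_
    ; isEquivalence = record
      { refl  = meq refl refl refl refl
      ; sym   = λ (meq a b c d) → meq (sym a) (sym b) (sym c) (sym d)
      ; trans = λ (meq a b c d) (meq a′ b′ c′ d′) → meq (trans a a′) (trans b b′) (trans c c′) (trans d d′) } }

  open Setoid matSetoid public using () renaming (refl to ≈M-refl; sym to ≈M-sym; trans to ≈M-trans)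
  module ≈M-Reasoning = Relation.Binary.Reasoning.Setoid matSetoid
  module ≈-Reasoning = Relation.Binary.Reasoning.Setoid setoid

  ·-cong : ∀ {X X′ Y Y′} → X ≈M X′ → Y ≈M Y′ → X · Y ≈M X′ · Y′
  ·-cong {mat _ _ _ _} {mat _ _ _ _} {mat _ _ _ _} {mat _ _ _ _} (meq a b c d) (meq e f g h) =
    meq (+-cong (*-cong a e) (*-cong b g)) (+-cong (*-cong a f) (*-cong b h))
        (+-cong (*-cong c e) (*-cong d g)) (+-cong (*-cong c f) (*-cong d h))

  ·-congˡ : ∀ {X Y Y′} → Y ≈M Y′ → X · Y ≈M X · Y′
  ·-congˡ = ·-cong ≈M-refl

  ·-congʳ : ∀ {X X′ Y} → X ≈M X′ → X · Y ≈M X′ · Y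
  ·-congʳ e = ·-cong e ≈M-refl

  ·-assoc : ∀ X Y Z → (X · Y) · Z ≈M X · (Y · Z)
  ·-assoc (mat a b c d) (mat e f g h) (mat i j k l) =
    meq (entry a b e f g h i k) (entry a b e f g h j l) (entry c d e f g h i k) (entry c d e f g h j l)
    where
    entry : ∀ a b e f g h i k → (a * e + b * g) * i + (a * f + b * h) * k ≈ a * (e * i + f * k) + b * (g * i + h * k)
    entry = solve 8 (λ a b e f g h i k → (a :* e :+ b :* g) :* i :+ (a :* f :+ b :* h) :* k
                                      := a :* (e :* i :+ f :* k) :+ b :* (g :* i :+ h :* k)) refl

  ·-identityˡ : ∀ X → idMat · X ≈M X
  ·-identityˡ (mat a b c d) = meq (first a c) (first b d) (second a c) (second b d)
    where
    first : ∀ x y → 1# * x + 0# * y ≈ x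
    first  = solve 2 (λ x y → :1 :* x :+ :0 :* y := x) refl
    second : ∀ x y → 0# * x + 1# * y ≈ y
    second = solve 2 (λ x y → :0 :* x :+ :1 :* y := y) refl

  ·-identityʳ : ∀ X → X · idMat ≈M X
  ·-identityʳ (mat a b c d) = meq (first a b) (second a b) (first c d) (second c d)
    where
    first : ∀ x y → x * 1# + y * 0# ≈ x
    first  = solve 2 (λ x y → x :* :1 :+ y :* :0 := x) refl
    second : ∀ x y → x * 0# + y * 1# ≈ y
    second = solve 2 (λ x y → x :* :0 :+ y :* :1 := y) refl

  E-cong : ∀ {a b} → a ≈ b → E a ≈M E b
  E-cong e = meq e refl refl refl

  Mgo-cong : ∀ {n X Y} {as bs : Vec Carrier n} → X ≈M Y → Pointwise _≈_ as bs → Mgo X as ≈M Mgo Y bs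
  Mgo-cong e []         = e
  Mgo-cong e (a≈b ∷ r) = Mgo-cong (·-cong (E-cong a≈b) e) r

  K-cong : ∀ {n} {as bs : Vec Carrier n} → Pointwise _≈_ as bs → K as ≈ K bs
  K-cong r = _≈M_.e11 (Mgo-cong ≈M-refl r)

  Mgo≈M· : ∀ {n} (as : Vec Carrier n) X → Mgo X as ≈M M as · X
  Mgo≈M· []       X = ≈M-sym (·-identityˡ X)
  Mgo≈M· (a ∷ as) X = begin
    Mgo (E a · X) as                 ≈⟨ Mgo≈M· as (E a · X) ⟩
    M as · (E a · X)                 ≈⟨ ·-congˡ (·-congʳ (·-identityʳ (E a))) ⟨
    M as · (E a · idMat · X)         ≈⟨ ·-assoc (M as) (E a · idMat) X ⟨
    M as · (E a · idMat) · X         ≈⟨ ·-congʳ (Mgo≈M· as (E a · idMat)) ⟨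
    Mgo (E a · idMat) as · X         ∎
    where open ≈M-Reasoning

  Mgo-++ : ∀ {k l} X (u : Vec Carrier k) (w : Vec Carrier l) → Mgo X (u ++ w) ≡ Mgo (Mgo X u) w
  Mgo-++ X []      w = ≡.refl
  Mgo-++ X (a ∷ u) w = Mgo-++ (E a · X) u w

  M-∷ : ∀ {n} a (as : Vec Carrier n) → M (a ∷ as) ≈M M as · E a
  M-∷ a as = ≈M-trans (Mgo≈M· as (E a · idMat)) (·-congˡ (·-identityʳ (E a)))

  det-E· : ∀ a X → det (E a · X) ≈ det X
  det-E· a (mat p q r s) = solve 5 (λ a p q r s →
    (a :* p :+ (:- :1) :* r) :* (:1 :* q :+ :0 :* s) :- (a :* q :+ (:- :1) :* s) :* (:1 :* p :+ :0 :* r)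
    := p :* s :- q :* r) refl a p q r s

  det-Mgo : ∀ {n} (as : Vec Carrier n) X → det (Mgo X as) ≈ det X
  det-Mgo []       X = refl
  det-Mgo (a ∷ as) X = trans (det-Mgo as (E a · X)) (det-E· a X)

  det-M : ∀ {n} (as : Vec Carrier n) → det (M as) ≈ 1#
  det-M as = trans (det-Mgo as idMat) (solve 0 (:1 :* :1 :- :0 :* :0 := :1) refl)

  K-∷ : ∀ {n} a (as : Vec Carrier n) → K (a ∷ as) ≈ K as * a + m12 (M as) * 1#
  K-∷ a as = _≈M_.e11 (M-∷ a as)

  K-consecutive-zeros : ∀ {n} a (cs : Vec Carrier n) → K cs ≈ 0# → K (a ∷ cs) ≈ 0# → 1# ≈ 0#
  K-consecutive-zeros a cs k≈0 k′≈0 = begin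
    1#                                           ≈⟨ det-M cs ⟨
    K cs * m22 (M cs) - m12 (M cs) * m21 (M cs)  ≈⟨ +-cong (*-congʳ k≈0) (-‿cong (*-congʳ b≈0)) ⟩
    0# * m22 (M cs) - 0# * m21 (M cs)            ≈⟨ solve 2 (λ x y → :0 :* x :- :0 :* y := :0) refl _ _ ⟩
    0#                                           ∎
    where
    open ≈-Reasoning
    b≈0 : m12 (M cs) ≈ 0#
    b≈0 = begin
      m12 (M cs)                    ≈⟨ solve 2 (λ b a → b := :0 :* a :+ b :* :1) refl _ a ⟩
      0# * a + m12 (M cs) * 1#      ≈⟨ +-congʳ (*-congʳ k≈0) ⟨
      K cs * a + m12 (M cs) * 1#    ≈⟨ K-∷ a cs ⟨
      K (a ∷ cs)                    ≈⟨ k′≈0 ⟩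
      0#                            ∎

  K-∷-root : ∀ {n d} (cs : Vec Carrier n) → K cs * d ≈ 1# → ∀ a → K (a ∷ cs) ≈ 0# ⇔ a ≈ - (m12 (M cs) * d)
  K-∷-root {d = d} cs kd≈1 a = mk⇔ forward backward
    where
    open ≈-Reasoning
    B : Carrier
    B = m12 (M cs)
    forward : K (a ∷ cs) ≈ 0# → a ≈ - (B * d)
    forward k′≈0 = begin
      a
        ≈⟨ trans (*-congˡ kd≈1) (*-identityʳ a) ⟨
      a * (K cs * d)
        ≈⟨ solve 4 (λ a k b d → a :* (k :* d) := (k :* a :+ b :* :1) :* d :- b :* d) refl a (K cs) B d ⟩
      (K cs * a + B * 1#) * d - B * d
        ≈⟨ +-congʳ (*-congʳ (trans (sym (K-∷ a cs)) k′≈0)) ⟩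
      0# * d - B * d
        ≈⟨ solve 2 (λ b d → :0 :* d :- b :* d := :- (b :* d)) refl B d ⟩
      - (B * d) ∎
    backward : a ≈ - (B * d) → K (a ∷ cs) ≈ 0#
    backward a≈root = begin
      K (a ∷ cs)
        ≈⟨ K-∷ a cs ⟩
      K cs * a + B * 1#
        ≈⟨ +-congʳ (*-congˡ a≈root) ⟩
      K cs * - (B * d) + B * 1#
        ≈⟨ solve 3 (λ k b d → k :* (:- (b :* d)) :+ b :* :1 := b :* :1 :- b :* (k :* d)) refl (K cs) B d ⟩
      B * 1# - B * (K cs * d)
        ≈⟨ +-congˡ (-‿cong (*-congˡ kd≈1)) ⟩
      B * 1# - B * 1#
        ≈⟨ -‿inverseʳ _ ⟩
      0# ∎

  -- Used with g = M(a₁,…,aₙ), which has determinant 1 and E c · (E b · g) = M(a₁,…,aₙ,b,c).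
  E·E·≈id⇔ : ∀ b c g → det g ≈ 1# →
    E c · (E b · g) ≈M idMat ⇔ (b ≈ - m21 g × c ≈ m12 g × m11 g ≈ - 1#)
  E·E·≈id⇔ b c (mat p q r s) det≈1 = mk⇔ forward backward
    where
    open ≈-Reasoning

    forward : E c · (E b · mat p q r s) ≈M idMat → b ≈ - r × c ≈ q × p ≈ - 1#
    forward (meq e11 e12 e21 e22) = b≈-r , c≈q , p≈-1
      where
      x y : Carrier
      x = b * p + - 1# * r
      y = b * q + - 1# * s
      x≈0 : x ≈ 0#
      x≈0 = trans (solve 3 (λ x p r → x := :1 :* x :+ :0 :* (:1 :* p :+ :0 :* r)) refl x p r) e21
      y≈1 : y ≈ 1#
      y≈1 = trans (solve 3 (λ y q s → y := :1 :* y :+ :0 :* (:1 :* q :+ :0 :* s)) refl y q s) e22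
      p≈-1 : p ≈ - 1#
      p≈-1 = begin
        p
          ≈⟨ solve 2 (λ c p → p := :- (c :* :0 :+ (:- :1) :* p)) refl c p ⟩
        - (c * 0# + - 1# * p)
          ≈⟨ -‿cong (+-cong (*-congˡ (sym x≈0)) (*-congˡ (solve 2 (λ p r → p := :1 :* p :+ :0 :* r) refl p r))) ⟩
        - (c * x + - 1# * (1# * p + 0# * r))
          ≈⟨ -‿cong e11 ⟩
        - 1# ∎
      b≈-r : b ≈ - r
      b≈-r = begin
        b
          ≈⟨ solve 2 (λ b r → b := :- (b :* (:- :1) :+ (:- :1) :* r) :+ :- r) refl b r ⟩
        - (b * - 1# + - 1# * r) + - r
          ≈⟨ +-congʳ (-‿cong (trans (+-congʳ (*-congˡ (sym p≈-1))) x≈0)) ⟩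
        - 0# + - r
          ≈⟨ solve 1 (λ r → :- :0 :+ :- r := :- r) refl r ⟩
        - r ∎
      c≈q : c ≈ q
      c≈q = begin
        c
          ≈⟨ solve 3 (λ c q s → c := c :* :1 :+ (:- :1) :* (:1 :* q :+ :0 :* s) :+ q) refl c q s ⟩
        c * 1# + - 1# * (1# * q + 0# * s) + q
          ≈⟨ +-congʳ (+-congʳ (*-congˡ (sym y≈1))) ⟩
        c * y + - 1# * (1# * q + 0# * s) + q
          ≈⟨ +-congʳ e12 ⟩
        0# + q
          ≈⟨ +-identityˡ q ⟩
        q ∎

    backward : b ≈ - r × c ≈ q × p ≈ - 1# → E c · (E b · mat p q r s) ≈M idMat
    backward (b≈-r , c≈q , p≈-1) =
      ≈M-trans (·-cong (E-cong c≈q) (·-cong (E-cong b≈-r) (meq p≈-1 refl refl refl)))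
        (meq (solve 2 (λ q r → q :* ((:- r) :* (:- :1) :+ (:- :1) :* r) :+ (:- :1) :* (:1 :* (:- :1) :+ :0 :* r) := :1) refl q r)
             (trans (+-congʳ (*-congˡ -rq-s≈1)) (solve 2 (λ q s → q :* :1 :+ (:- :1) :* (:1 :* q :+ :0 :* s) := :0) refl q s))
             (solve 1 (λ r → :1 :* ((:- r) :* (:- :1) :+ (:- :1) :* r) :+ :0 :* (:1 :* (:- :1) :+ :0 :* r) := :0) refl r)
             (trans (solve 3 (λ q r s → :1 :* ((:- r) :* q :+ (:- :1) :* s) :+ :0 :* (:1 :* q :+ :0 :* s)
                                        := (:- r) :* q :+ (:- :1) :* s) refl q r s) -rq-s≈1))
      where
      -rq-s≈1 : - r * q + - 1# * s ≈ 1#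
      -rq-s≈1 = trans (solve 3 (λ q r s → (:- r) :* q :+ (:- :1) :* s := (:- :1) :* s :- q :* r) refl q r s)
                      (trans (+-congʳ (*-congʳ (sym p≈-1))) det≈1)

  alternate : ∀ {n} → Carrier → Carrier → Vec Carrier n → Vec Carrier n
  alternate s t []       = []
  alternate s t (a ∷ as) = s * a ∷ alternate t s as

  alternate-cong : ∀ {s t n} {as bs : Vec Carrier n} → Pointwise _≈_ as bs →
    Pointwise _≈_ (alternate s t as) (alternate s t bs)
  alternate-cong []          = []
  alternate-cong (a≈b ∷ r) = *-congˡ a≈b ∷ alternate-cong r

  alternate-inverse : ∀ {s t s′ t′} → s′ * s ≈ 1# → t′ * t ≈ 1# →
    ∀ {n} (as : Vec Carrier n) → Pointwise _≈_ (alternate s′ t′ (alternate s t as)) as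
  alternate-inverse s′s≈1 t′t≈1 []       = []
  alternate-inverse s′s≈1 t′t≈1 (a ∷ as) =
    trans (sym (*-assoc _ _ a)) (trans (*-congʳ s′s≈1) (*-identityˡ a)) ∷ alternate-inverse t′t≈1 s′s≈1 as

  byParity : ℕ → Mat → Mat → Mat
  byParity zero    D₀ D₁ = D₀
  byParity (suc n) D₀ D₁ = byParity n D₁ D₀

  byParity-odd : ∀ k D₀ D₁ → byParity (suc (2 ℕ.* k)) D₀ D₁ ≡ D₁
  byParity-odd zero    D₀ D₁ = ≡.refl
  byParity-odd (suc k) D₀ D₁ rewrite ℕP.+-suc k (k ℕ.+ 0) = byParity-odd k D₀ D₁

  -- The intertwining relations telescope along the product E(aₙ) ⋯ E(a₁).
  M-alternate : ∀ {s t D₀ D₁} → (∀ a → D₁ · E (s * a) ≈M E a · D₀) → (∀ a → D₀ · E (t * a) ≈M E a · D₁) →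
    ∀ {n} (as : Vec Carrier n) → byParity n D₀ D₁ · M (alternate s t as) ≈M M as · D₀
  M-alternate {D₀ = D₀} _ _ [] = ≈M-trans (·-identityʳ D₀) (≈M-sym (·-identityˡ D₀))
  M-alternate {s} {t} {D₀} {D₁} swap-s swap-t {suc n} (a ∷ as) = begin
    byParity n D₁ D₀ · M (s * a ∷ alternate t s as)          ≈⟨ ·-congˡ (M-∷ (s * a) (alternate t s as)) ⟩
    byParity n D₁ D₀ · (M (alternate t s as) · E (s * a))    ≈⟨ ·-assoc _ _ _ ⟨
    byParity n D₁ D₀ · M (alternate t s as) · E (s * a)      ≈⟨ ·-congʳ (M-alternate swap-t swap-s as) ⟩
    M as · D₁ · E (s * a)                                    ≈⟨ ·-assoc _ _ _ ⟩
    M as · (D₁ · E (s * a))                                  ≈⟨ ·-congˡ (swap-s a) ⟩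
    M as · (E a · D₀)                                        ≈⟨ ·-assoc _ _ _ ⟨
    M as · E a · D₀                                          ≈⟨ ·-congʳ (M-∷ a as) ⟨
    M (a ∷ as) · D₀                                          ∎
    where open ≈M-Reasoning

  diag-swap : ∀ {u v} → v * u ≈ 1# → ∀ a → diag v 1# · E (u * a) ≈M E a · diag 1# v
  diag-swap {u} {v} vu≈1 a = meq
    (trans (solve 3 (λ u v a → v :* (u :* a) :+ :0 :* :1 := (v :* u) :* a) refl u v a)
      (trans (*-congʳ vu≈1) (solve 1 (λ a → :1 :* a := a :* :1 :+ (:- :1) :* :0) refl a)))
    (solve 2 (λ v a → v :* (:- :1) :+ :0 :* :0 := a :* :0 :+ (:- :1) :* v) refl v a)
    (solve 2 (λ u a → :0 :* (u :* a) :+ :1 :* :1 := :1 :* :1 :+ :0 :* :0) refl u a)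
    (solve 1 (λ v → :0 :* (:- :1) :+ :1 :* :0 := :1 :* :0 :+ :0 :* v) refl v)

  diag-swap′ : ∀ v a → diag 1# v · E (v * a) ≈M E a · diag v 1#
  diag-swap′ v a = meq
    (solve 2 (λ v a → :1 :* (v :* a) :+ :0 :* :1 := a :* v :+ (:- :1) :* :0) refl v a)
    (solve 1 (λ a → :1 :* (:- :1) :+ :0 :* :0 := a :* :0 :+ (:- :1) :* :1) refl a)
    (solve 2 (λ v a → :0 :* (v :* a) :+ v :* :1 := :1 :* v :+ :0 :* :0) refl v a)
    (solve 1 (λ v → :0 :* (:- :1) :+ v :* :0 := :1 :* :0 :+ :0 :* :1) refl v)

  K-alternate-odd : ∀ {u v} → u * v ≈ 1# → ∀ k (as : Vec Carrier (suc (2 ℕ.* k))) → K (alternate u v as) ≈ u * K as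
  K-alternate-odd {u} {v} uv≈1 k as = begin
    K (alternate u v as)            ≈⟨ *-identityˡ _ ⟨
    1# * K (alternate u v as)       ≈⟨ *-congʳ uv≈1 ⟨
    u * v * K (alternate u v as)    ≈⟨ *-assoc u v _ ⟩
    u * (v * K (alternate u v as))  ≈⟨ *-congˡ vK′≈K ⟩
    u * K as                        ∎
    where
    open ≈-Reasoning
    intertwined : diag v 1# · M (alternate u v as) ≈M M as · diag 1# v
    intertwined = ≡.subst (λ D → D · M (alternate u v as) ≈M M as · diag 1# v)
      (byParity-odd k (diag 1# v) (diag v 1#))
      (M-alternate (diag-swap (trans (*-comm v u) uv≈1)) (diag-swap′ v) as)
    vK′≈K : v * K (alternate u v as) ≈ K as
    vK′≈K = trans (solve 3 (λ v x y → v :* x := v :* x :+ :0 :* y) refl v _ _)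
      (trans (_≈M_.e11 intertwined) (solve 2 (λ x y → x :* :1 :+ y :* :0 := x) refl _ _))

module MatrixHomomorphism (R S : CommutativeRing 0ℓ 0ℓ) (φ : CommutativeRing.Carrier R → CommutativeRing.Carrier S)
  (φ-homo : IsRingHomomorphism (CommutativeRing.rawRing R) (CommutativeRing.rawRing S) φ) where
  open import Data.Vec using (Vec; []; _∷_; map)
  module R = CommutativeRing R
  module MR = Matrix R
  open CommutativeRing S
  open Matrix S
  open IsRingHomomorphism φ-homo

  mapMat : MR.Mat → Mat
  mapMat (MR.mat a b c d) = mat (φ a) (φ b) (φ c) (φ d)

  mapMat-· : ∀ X Y → mapMat (X MR.· Y) ≈M mapMat X · mapMat Y
  mapMat-· (MR.mat a b c d) (MR.mat e f g h) = meq (entry a e b g) (entry a f b h) (entry c e d g) (entry c f d h)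
    where
    entry : ∀ x y z w → φ (x R.* y R.+ z R.* w) ≈ φ x * φ y + φ z * φ w
    entry x y z w = trans (+-homo _ _) (+-cong (*-homo x y) (*-homo z w))

  mapMat-E : ∀ a → mapMat (MR.E a) ≈M E (φ a)
  mapMat-E a = meq refl (trans (-‿homo R.1#) (-‿cong 1#-homo)) 1#-homo 0#-homo

  mapMat-Mgo : ∀ {n} X (as : Vec R.Carrier n) → mapMat (MR.Mgo X as) ≈M Mgo (mapMat X) (map φ as)
  mapMat-Mgo X []       = ≈M-refl
  mapMat-Mgo X (a ∷ as) = ≈M-trans (mapMat-Mgo (MR.E a MR.· X) as)
    (Mgo-cong {as = map φ as} (≈M-trans (mapMat-· (MR.E a) X) (·-congʳ (mapMat-E a))) (Pointwise.refl refl))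

  K-homo : ∀ {n} (as : Vec R.Carrier n) → φ (MR.K as) ≈ K (map φ as)
  K-homo as = _≈M_.e11 (≈M-trans (mapMat-Mgo MR.idMat as) (Mgo-cong {as = map φ as} (meq 1#-homo 0#-homo 0#-homo 1#-homo) (Pointwise.refl refl)))

module TruncatedPolynomialRing {q : ℕ} (F : FiniteField q) (m : ℕ) where
  open FiniteField F hiding (zero)
  open Trunc F m using (A; coef; sumTo; _+A_; _*A_; -A_; 0A; 1A)
  open CommutativeRingSolver commRing
  open import Data.Nat using (_∸_; _≤_; _<_; z≤n; s≤s; _<?_)
  import Data.Nat.Properties as ℕP
  open import Data.Fin using (Fin; toℕ; fromℕ<)
  open import Data.Fin.Properties using (toℕ<n; fromℕ<-toℕ; toℕ-fromℕ<)
  open import Data.Empty using (⊥-elim)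
  open import Relation.Nullary using (yes; no; ¬_)
  open import Relation.Binary.Reasoning.Setoid setoid

  sumTo-cong≤ : ∀ k {f g : ℕ → Carrier} → (∀ j → j ≤ k → f j ≈ g j) → sumTo f k ≈ sumTo g k
  sumTo-cong≤ zero    e = e 0 z≤n
  sumTo-cong≤ (suc k) e = +-cong (sumTo-cong≤ k (λ j p → e j (ℕP.m≤n⇒m≤1+n p))) (e (suc k) ℕP.≤-refl)

  sumTo-cong : ∀ k {f g : ℕ → Carrier} → (∀ j → f j ≈ g j) → sumTo f k ≈ sumTo g k
  sumTo-cong k e = sumTo-cong≤ k (λ j _ → e j)

  sumTo-+ : ∀ k (f g : ℕ → Carrier) → sumTo (λ j → f j + g j) k ≈ sumTo f k + sumTo g k
  sumTo-+ zero    f g = refl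
  sumTo-+ (suc k) f g = trans (+-congʳ (sumTo-+ k f g))
    (solve 4 (λ a b c d → (a :+ b) :+ (c :+ d) := (a :+ c) :+ (b :+ d)) refl _ _ _ _)

  sumTo-*ˡ : ∀ k c (f : ℕ → Carrier) → sumTo (λ j → c * f j) k ≈ c * sumTo f k
  sumTo-*ˡ zero    c f = refl
  sumTo-*ˡ (suc k) c f = trans (+-congʳ (sumTo-*ˡ k c f)) (sym (distribˡ c _ _))

  sumTo-*ʳ : ∀ k c (f : ℕ → Carrier) → sumTo (λ j → f j * c) k ≈ sumTo f k * c
  sumTo-*ʳ zero    c f = refl
  sumTo-*ʳ (suc k) c f = trans (+-congʳ (sumTo-*ʳ k c f)) (sym (distribʳ c _ _))

  sumTo-zero : ∀ k (f : ℕ → Carrier) → (∀ j → j ≤ k → f j ≈ 0#) → sumTo f k ≈ 0#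
  sumTo-zero zero    f e = e 0 z≤n
  sumTo-zero (suc k) f e =
    trans (+-cong (sumTo-zero k f (λ j p → e j (ℕP.m≤n⇒m≤1+n p))) (e (suc k) ℕP.≤-refl)) (+-identityˡ 0#)

  sumTo-suc : ∀ k (f : ℕ → Carrier) → sumTo f (suc k) ≈ f 0 + sumTo (λ j → f (suc j)) k
  sumTo-suc zero    f = refl
  sumTo-suc (suc k) f = trans (+-congʳ (sumTo-suc k f)) (+-assoc _ _ _)

  sumTo-reverse : ∀ k (f : ℕ → Carrier) → sumTo f k ≈ sumTo (λ j → f (k ∸ j)) k
  sumTo-reverse zero    f = refl
  sumTo-reverse (suc k) f = begin
    sumTo f k + f (suc k)                   ≈⟨ +-congʳ (sumTo-reverse k f) ⟩
    sumTo (λ j → f (k ∸ j)) k + f (suc k)   ≈⟨ +-comm _ _ ⟩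
    f (suc k) + sumTo (λ j → f (k ∸ j)) k   ≈⟨ sumTo-suc k (λ j → f (suc k ∸ j)) ⟨
    sumTo (λ j → f (suc k ∸ j)) (suc k)     ∎

  sumTo-exchange : ∀ k (G : ℕ → ℕ → Carrier) →
    sumTo (λ j → sumTo (λ i → G i j) j) k ≈ sumTo (λ i → sumTo (λ l → G i (i ℕ.+ l)) (k ∸ i)) k
  sumTo-exchange zero    G = refl
  sumTo-exchange (suc k) G = begin
    sumTo (λ j → sumTo (λ i → G i j) j) k + sumTo (λ i → G i (suc k)) (suc k)
      ≈⟨ +-congʳ (sumTo-exchange k G) ⟩
    sumTo (H k) k + (sumTo (λ i → G i (suc k)) k + G (suc k) (suc k))
      ≈⟨ +-assoc _ _ _ ⟨
    (sumTo (H k) k + sumTo (λ i → G i (suc k)) k) + G (suc k) (suc k)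
      ≈⟨ +-cong (sym (sumTo-+ k (H k) (λ i → G i (suc k)))) (reflexive (≡.cong (G (suc k)) (≡.sym (ℕP.+-identityʳ (suc k))))) ⟩
    sumTo (λ i → H k i + G i (suc k)) k + G (suc k) (suc k ℕ.+ 0)
      ≈⟨ +-congʳ (sumTo-cong≤ k extend) ⟩
    sumTo (H (suc k)) k + sumTo (λ l → G (suc k) (suc k ℕ.+ l)) 0
      ≈⟨ reflexive (≡.cong (λ z → sumTo (H (suc k)) k + sumTo (λ l → G (suc k) (suc k ℕ.+ l)) z) (≡.sym (ℕP.n∸n≡0 k))) ⟩
    sumTo (H (suc k)) (suc k) ∎
    where
    H : ℕ → ℕ → Carrier
    H k i = sumTo (λ l → G i (i ℕ.+ l)) (k ∸ i)
    extend : ∀ i → i ≤ k → H k i + G i (suc k) ≈ H (suc k) i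
    extend i i≤k = begin
      sumTo (λ l → G i (i ℕ.+ l)) (k ∸ i) + G i (suc k)
        ≈⟨ +-congˡ (reflexive (≡.cong (G i) (≡.sym (≡.trans (ℕP.+-suc i (k ∸ i)) (≡.cong suc (ℕP.m+[n∸m]≡n i≤k)))))) ⟩
      sumTo (λ l → G i (i ℕ.+ l)) (suc (k ∸ i))
        ≈⟨ reflexive (≡.cong (sumTo (λ l → G i (i ℕ.+ l))) (≡.sym (ℕP.+-∸-assoc 1 i≤k))) ⟩
      sumTo (λ l → G i (i ℕ.+ l)) (suc k ∸ i) ∎

  conv : (ℕ → Carrier) → (ℕ → Carrier) → ℕ → Carrier
  conv f g k = sumTo (λ j → f j * g (k ∸ j)) k

  conv-cong≤ : ∀ k {f f′ g g′} → (∀ j → j ≤ k → f j ≈ f′ j) → (∀ j → j ≤ k → g j ≈ g′ j) → conv f g k ≈ conv f′ g′ k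
  conv-cong≤ k ef eg = sumTo-cong≤ k (λ j p → *-cong (ef j p) (eg (k ∸ j) (ℕP.m∸n≤m k j)))

  conv-comm : ∀ f g k → conv f g k ≈ conv g f k
  conv-comm f g k = trans (sumTo-reverse k _)
    (sumTo-cong≤ k (λ j p → trans (*-comm _ _) (*-congʳ (reflexive (≡.cong g (ℕP.m∸[m∸n]≡n p))))))

  conv-assoc : ∀ f g h k → conv (conv f g) h k ≈ conv f (conv g h) k
  conv-assoc f g h k = begin
    sumTo (λ j → sumTo (λ i → f i * g (j ∸ i)) j * h (k ∸ j)) k
      ≈⟨ sumTo-cong k (λ j → sym (sumTo-*ʳ j (h (k ∸ j)) _)) ⟩
    sumTo (λ j → sumTo (λ i → f i * g (j ∸ i) * h (k ∸ j)) j) k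
      ≈⟨ sumTo-exchange k (λ i j → f i * g (j ∸ i) * h (k ∸ j)) ⟩
    sumTo (λ i → sumTo (λ l → f i * g (i ℕ.+ l ∸ i) * h (k ∸ (i ℕ.+ l))) (k ∸ i)) k
      ≈⟨ sumTo-cong k (λ i → sumTo-cong (k ∸ i) (λ l → trans (*-assoc _ _ _)
           (*-congˡ (*-cong (reflexive (≡.cong g (ℕP.m+n∸m≡n i l))) (reflexive (≡.cong h (≡.sym (ℕP.∸-+-assoc k i l)))))))) ⟩
    sumTo (λ i → sumTo (λ l → f i * (g l * h (k ∸ i ∸ l))) (k ∸ i)) k
      ≈⟨ sumTo-cong k (λ i → sumTo-*ˡ (k ∸ i) (f i) _) ⟩
    sumTo (λ i → f i * sumTo (λ l → g l * h (k ∸ i ∸ l)) (k ∸ i)) k ∎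

  conv-distribˡ : ∀ f g h k → conv f (λ j → g j + h j) k ≈ conv f g k + conv f h k
  conv-distribˡ f g h k = trans (sumTo-cong k (λ j → distribˡ _ _ _)) (sumTo-+ k _ _)

  infix 4 _≈A_
  _≈A_ : A → A → Set
  a ≈A b = ∀ i → a i ≈ b i

  coef-< : ∀ a j (j<m : j < m) → coef a j ≡ a (fromℕ< j<m)
  coef-< a j j<m with j <? m
  ... | yes _  = ≡.refl
  ... | no j≮m = ⊥-elim (j≮m j<m)

  coef-≮ : ∀ a j → ¬ j < m → coef a j ≡ 0#
  coef-≮ a j j≮m with j <? m
  ... | yes j<m = ⊥-elim (j≮m j<m)
  ... | no _    = ≡.refl

  coef-toℕ : ∀ a (i : Fin m) → coef a (toℕ i) ≡ a i
  coef-toℕ a i = ≡.trans (coef-< a (toℕ i) (toℕ<n i)) (≡.cong a (fromℕ<-toℕ i (toℕ<n i)))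

  coef-cong : ∀ {a b} → a ≈A b → ∀ j → coef a j ≈ coef b j
  coef-cong {a} {b} e j with j <? m
  ... | yes j<m = e (fromℕ< j<m)
  ... | no _    = refl

  ≈A-by-coef : ∀ {a b} → (∀ j → j < m → coef a j ≈ coef b j) → a ≈A b
  ≈A-by-coef {a} {b} e i = trans (reflexive (≡.sym (coef-toℕ a i))) (trans (e (toℕ i) (toℕ<n i)) (reflexive (coef-toℕ b i)))

  coef-+ : ∀ a b j → coef (a +A b) j ≈ coef a j + coef b j
  coef-+ a b j with j <? m
  ... | yes _ = refl
  ... | no _  = sym (+-identityˡ 0#)

  coef-* : ∀ a b j → j < m → coef (a *A b) j ≈ conv (coef a) (coef b) j
  coef-* a b j j<m = reflexive (≡.trans (coef-< (a *A b) j j<m) (≡.cong (conv (coef a) (coef b)) (toℕ-fromℕ< j<m)))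

  coef-0A : ∀ j → coef 0A j ≡ 0#
  coef-0A j with j <? m
  ... | yes _ = ≡.refl
  ... | no _  = ≡.refl

  coef-1A-zero : 0 < m → coef 1A 0 ≡ 1#
  coef-1A-zero 0<m@(s≤s z≤n) = coef-< 1A 0 0<m

  coef-1A-suc : ∀ j → coef 1A (suc j) ≈ 0#
  coef-1A-suc j with suc j <? m
  ... | yes (s≤s _) = refl
  ... | no _        = refl

  *A-cong : ∀ {a a′ b b′} → a ≈A a′ → b ≈A b′ → a *A b ≈A a′ *A b′
  *A-cong ea eb i = sumTo-cong (toℕ i) (λ j → *-cong (coef-cong ea j) (coef-cong eb (toℕ i ∸ j)))

  *A-comm : ∀ a b → a *A b ≈A b *A a
  *A-comm a b = ≈A-by-coef (λ j j<m → trans (coef-* a b j j<m) (trans (conv-comm _ _ j) (sym (coef-* b a j j<m))))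

  *A-assoc : ∀ a b c → (a *A b) *A c ≈A a *A (b *A c)
  *A-assoc a b c = ≈A-by-coef (λ j j<m → begin
    coef ((a *A b) *A c) j
      ≈⟨ coef-* _ _ j j<m ⟩
    conv (coef (a *A b)) (coef c) j
      ≈⟨ conv-cong≤ j {g = coef c} (λ i i≤j → coef-* a b i (ℕP.≤-<-trans i≤j j<m)) (λ _ _ → refl) ⟩
    conv (conv (coef a) (coef b)) (coef c) j
      ≈⟨ conv-assoc (coef a) (coef b) (coef c) j ⟩
    conv (coef a) (conv (coef b) (coef c)) j
      ≈⟨ conv-cong≤ j {f = coef a} (λ _ _ → refl) (λ i i≤j → sym (coef-* b c i (ℕP.≤-<-trans i≤j j<m))) ⟩
    conv (coef a) (coef (b *A c)) j
      ≈⟨ coef-* _ _ j j<m ⟨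
    coef (a *A (b *A c)) j                    ∎)

  *A-identityˡ : ∀ a → 1A *A a ≈A a
  *A-identityˡ a = ≈A-by-coef (λ j j<m → trans (coef-* 1A a j j<m) (conv-1A j (ℕP.≤-<-trans z≤n j<m)))
    where
    conv-1A : ∀ k → 0 < m → conv (coef 1A) (coef a) k ≈ coef a k
    conv-1A zero    0<m = trans (*-congʳ (reflexive (coef-1A-zero 0<m))) (*-identityˡ _)
    conv-1A (suc k) 0<m = begin
      conv (coef 1A) (coef a) (suc k)
        ≈⟨ sumTo-suc k _ ⟩
      coef 1A 0 * coef a (suc k) + sumTo (λ j → coef 1A (suc j) * coef a (k ∸ j)) k
        ≈⟨ +-cong (*-congʳ (reflexive (coef-1A-zero 0<m)))
                  (sumTo-zero k _ (λ j _ → trans (*-congʳ (coef-1A-suc j)) (zeroˡ _))) ⟩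
      1# * coef a (suc k) + 0#
        ≈⟨ solve 1 (λ x → :1 :* x :+ :0 := x) refl _ ⟩
      coef a (suc k) ∎

  *A-distribˡ : ∀ a b c → a *A (b +A c) ≈A (a *A b) +A (a *A c)
  *A-distribˡ a b c = ≈A-by-coef (λ j j<m → begin
    coef (a *A (b +A c)) j
      ≈⟨ coef-* _ _ j j<m ⟩
    conv (coef a) (coef (b +A c)) j
      ≈⟨ conv-cong≤ j (λ _ _ → refl) (λ i _ → coef-+ b c i) ⟩
    conv (coef a) (λ i → coef b i + coef c i) j
      ≈⟨ conv-distribˡ (coef a) (coef b) (coef c) j ⟩
    conv (coef a) (coef b) j + conv (coef a) (coef c) j
      ≈⟨ +-cong (coef-* a b j j<m) (coef-* a c j j<m) ⟨
    coef (a *A b) j + coef (a *A c) j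
      ≈⟨ coef-+ _ _ j ⟨
    coef ((a *A b) +A (a *A c)) j                        ∎)

  A-isCommutativeRing : IsCommutativeRing _≈A_ _+A_ _*A_ -A_ 0A 1A
  A-isCommutativeRing = record
    { isRing = record
      { +-isAbelianGroup = record
        { isGroup = record
          { isMonoid = record
            { isSemigroup = record
              { isMagma = record
                { isEquivalence = record { refl = λ i → refl ; sym = λ e i → sym (e i) ; trans = λ e f i → trans (e i) (f i) }
                ; ∙-cong = λ e f i → +-cong (e i) (f i) }
              ; assoc = λ a b c i → +-assoc (a i) (b i) (c i) }
            ; identity = (λ a i → +-identityˡ (a i)) , (λ a i → +-identityʳ (a i)) }
          ; inverse = (λ a i → -‿inverseˡ (a i)) , (λ a i → -‿inverseʳ (a i))
          ; ⁻¹-cong = λ e i → -‿cong (e i) }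
        ; comm = λ a b i → +-comm (a i) (b i) }
      ; *-cong = *A-cong
      ; *-assoc = *A-assoc
      ; *-identity = *A-identityˡ , (λ a i → trans (*A-comm a 1A i) (*A-identityˡ a i))
      ; distrib = *A-distribˡ
                , (λ a b c i → trans (*A-comm (b +A c) a i) (trans (*A-distribˡ a b c i) (+-cong (*A-comm a b i) (*A-comm a c i))))
      }
    ; *-comm = *A-comm
    }

  ringA : CommutativeRing 0ℓ 0ℓ
  ringA = record { isCommutativeRing = A-isCommutativeRing }

module GeometricSeries (R : CommutativeRing 0ℓ 0ℓ) where
  open CommutativeRing R hiding (zero)
  open import Algebra.Definitions.RawSemiring (RawRing.rawSemiring rawRing) using (_^_)
  open CommutativeRingSolver R

  geometricSum : Carrier → ℕ → Carrier
  geometricSum x zero    = 0#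
  geometricSum x (suc k) = 1# + x * geometricSum x k

  geometricSum-telescopes : ∀ x k → (1# - x) * geometricSum x k ≈ 1# - x ^ k
  geometricSum-telescopes x zero    = solve 1 (λ x → (:1 :- x) :* :0 := :1 :- :1) refl x
  geometricSum-telescopes x (suc k) = begin
    (1# - x) * (1# + x * geometricSum x k)
      ≈⟨ solve 2 (λ x g → (:1 :- x) :* (:1 :+ x :* g) := (:1 :- x) :+ x :* ((:1 :- x) :* g)) refl x _ ⟩
    (1# - x) + x * ((1# - x) * geometricSum x k)
      ≈⟨ +-congˡ (*-congˡ (geometricSum-telescopes x k)) ⟩
    (1# - x) + x * (1# - x ^ k)
      ≈⟨ solve 2 (λ x p → (:1 :- x) :+ x :* (:1 :- p) := :1 :- x :* p) refl x _ ⟩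
    1# - x * x ^ k ∎
    where open import Relation.Binary.Reasoning.Setoid setoid

  1-nilpotent-invertible : ∀ x k → x ^ k ≈ 0# → (1# - x) * geometricSum x k ≈ 1#
  1-nilpotent-invertible x k xᵏ≈0 =
    trans (geometricSum-telescopes x k) (trans (+-congˡ (-‿cong xᵏ≈0)) (solve 0 (:1 :- :0 := :1) refl))

module TruncatedPolynomialUnits {q : ℕ} (F : FiniteField q) (m′ : ℕ) where
  open FiniteField F hiding (zero)
  open Trunc F (suc m′) using (A; coef; _*A_)
  open TruncatedPolynomialRing F (suc m′)
  open import Data.Nat using (_∸_; _≤_; _<_; z≤n; s≤s; _<?_)
  import Data.Nat.Properties as ℕP
  open import Data.Fin using () renaming (zero to fzero; suc to fsuc)
  open import Data.Product using (∃; proj₁; proj₂)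
  open import Relation.Nullary using (Dec; yes; no; ¬_)
  module RA = CommutativeRing ringA
  open import Algebra.Definitions.RawSemiring (RawRing.rawSemiring RA.rawRing) using (_^_)
  open GeometricSeries ringA using (geometricSum; 1-nilpotent-invertible)

  constantTerm : A → Carrier
  constantTerm a = a fzero

  constantTerm-isRingHomomorphism : IsRingHomomorphism RA.rawRing rawRing constantTerm
  constantTerm-isRingHomomorphism = record
    { isSemiringHomomorphism = record
      { isNearSemiringHomomorphism = record
        { +-isMonoidHomomorphism = record
          { isMagmaHomomorphism = record { isRelHomomorphism = record { cong = λ e → e fzero } ; homo = λ _ _ → refl }
          ; ε-homo = refl }
        ; *-homo = λ _ _ → refl }
      ; 1#-homo = refl }
    ; -‿homo = λ _ → refl }

  ∸-suc-< : ∀ {i j k} → suc i ≤ j → j < suc k → j ∸ suc i < k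
  ∸-suc-< {i} {suc j} (s≤s i≤j) (s≤s j<k) = ℕP.≤-<-trans (ℕP.m∸n≤m j i) j<k

  constantTerm≈0⇒nilpotent : ∀ x → constantTerm x ≈ 0# → x ^ suc m′ RA.≈ RA.0#
  constantTerm≈0⇒nilpotent x x₀≈0 = ≈A-by-coef (λ j j<m → trans (low-coefficients-vanish (suc m′) j j<m) (reflexive (≡.sym (coef-0A j))))
    where
    low-coefficients-vanish : ∀ k j → j < k → coef (x ^ k) j ≈ 0#
    low-coefficients-vanish (suc k) j j<1+k = by-cases (j <? suc m′)
      where
      term≈0 : ∀ i → i ≤ j → coef x i * coef (x ^ k) (j ∸ i) ≈ 0#
      term≈0 zero    _ = trans (*-congʳ (trans (reflexive (coef-< x 0 (s≤s z≤n))) x₀≈0)) (zeroˡ _)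
      term≈0 (suc i) 1+i≤j = trans (*-congˡ (low-coefficients-vanish k (j ∸ suc i) (∸-suc-< 1+i≤j j<1+k))) (zeroʳ _)
      by-cases : Dec (j < suc m′) → coef (x ^ suc k) j ≈ 0#
      by-cases (no j≮m)  = reflexive (coef-≮ (x ^ suc k) j j≮m)
      by-cases (yes j<m) = trans (coef-* x (x ^ k) j j<m) (sumTo-zero j _ term≈0)

  constant : Carrier → A
  constant d fzero    = d
  constant d (fsuc _) = 0#

  -- With d t₀ = 1, the element x = 1 − d t is nilpotent, so d (1 + x + ⋯ + x^m′) inverts t.
  constantTerm≉0⇒invertible : ∀ t → ¬ (constantTerm t ≈ 0#) → ∃ λ w → t *A w RA.≈ RA.1#
  constantTerm≉0⇒invertible t t₀≉0 = constant d *A G , tw≈1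
    where
    open CommutativeRingSolver ringA
    d : Carrier
    d = proj₁ (inverse (t fzero) t₀≉0)
    y x G : A
    y = constant d *A t
    x = RA.1# RA.- y
    G = geometricSum x (suc m′)
    x₀≈0 : constantTerm x ≈ 0#
    x₀≈0 = trans (+-congˡ (-‿cong (trans (*-comm d (t fzero)) (proj₂ (inverse (t fzero) t₀≉0))))) (-‿inverseʳ 1#)
    tw≈1 : t *A (constant d *A G) RA.≈ RA.1#
    tw≈1 = RA.trans (solve 3 (λ t c g → t :* (c :* g) := (:1 :- (:1 :- c :* t)) :* g) RA.refl t (constant d) G)
                    (1-nilpotent-invertible x (suc m′) (constantTerm≈0⇒nilpotent x x₀≈0))

module Arithmetic where
  open import Data.Nat using (_+_; _*_; _^_; _∸_)
  import Data.Nat.Properties as ℕP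
  open import Data.Bool using (Bool; true; false; not)
  open import Data.Bool.Properties using (not-involutive)
  open import Data.Nat.Solver using (module +-*-Solver)
  open +-*-Solver
  open Sums using ([_])
  open ≡.≡-Reasoning

  isEven : ℕ → Bool
  isEven zero    = true
  isEven (suc n) = not (isEven n)

  isEven-odd : ∀ k → isEven (suc (2 * k)) ≡ false
  isEven-odd zero    = ≡.refl
  isEven-odd (suc k) rewrite ℕP.+-suc k (k + 0) | isEven-odd k = ≡.refl

  -- z n = q^(n-1) − q^(n-2) + ⋯ ± 1
  alternating-closed-form : ∀ q (z : ℕ → ℕ) → z 0 ≡ 0 → (∀ n → z (suc n) + z n ≡ q ^ n) →
    ∀ n → suc q * z n + [ isEven n ] ≡ q ^ n + [ not (isEven n) ]
  alternating-closed-form q z z0≡0 consecutive zero = ≡.trans (≡.cong (λ c → suc q * c + 1) z0≡0) (≡.cong (_+ 1) (ℕP.*-zeroʳ (suc q)))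
  alternating-closed-form q z z0≡0 consecutive (suc n) = ℕP.+-cancelˡ-≡ (q ^ n) _ _ (begin
    q ^ n + (suc q * z (suc n) + [ not (isEven n) ])
      ≡⟨ solve 4 (λ x s a e → x :+ (s :* a :+ e) := s :* a :+ (x :+ e)) ≡.refl (q ^ n) (suc q) (z (suc n)) [ not (isEven n) ] ⟩
    suc q * z (suc n) + (q ^ n + [ not (isEven n) ])
      ≡⟨ ≡.cong (suc q * z (suc n) +_) (alternating-closed-form q z z0≡0 consecutive n) ⟨
    suc q * z (suc n) + (suc q * z n + [ isEven n ])
      ≡⟨ solve 4 (λ s a b e → s :* a :+ (s :* b :+ e) := s :* (a :+ b) :+ e) ≡.refl (suc q) (z (suc n)) (z n) [ isEven n ] ⟩
    suc q * (z (suc n) + z n) + [ isEven n ]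
      ≡⟨ ≡.cong (λ c → suc q * c + [ isEven n ]) (consecutive n) ⟩
    suc q * q ^ n + [ isEven n ]
      ≡⟨ solve 3 (λ q x e → (con 1 :+ q) :* x :+ e := x :+ (q :* x :+ e)) ≡.refl q (q ^ n) [ isEven n ] ⟩
    q ^ n + (q * q ^ n + [ isEven n ])
      ≡⟨ ≡.cong (λ b → q ^ n + (q * q ^ n + [ b ])) (not-involutive (isEven n)) ⟨
    q ^ n + (q ^ suc n + [ not (not (isEven n)) ]) ∎)

  final-formula : ∀ q m′ n W u Z N → u + 1 ≡ q → q ^ m′ * u * W ≡ (q ^ m′) ^ n * N →
    Z + N ≡ q ^ n → suc q * Z ≡ q ^ n + 1 →
    W * (q ^ m′ * (q ^ 2 ∸ 1)) ≡ q ^ (n * suc m′ + 1) ∸ q ^ (n * m′)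
  final-formula .(u + 1) m′ n W u Z N ≡.refl double-count Z+N≡qⁿ Z-closed = ≡.sym (begin
    q ^ (n * suc m′ + 1) ∸ b
      ≡⟨ ≡.cong (_∸ b) split-power ⟩
    b * (x * q) ∸ b
      ≡⟨ ≡.cong (λ z → b * z ∸ b) N-closed ⟨
    b * (1 + suc q * N) ∸ b
      ≡⟨ ≡.cong (_∸ b) (solve 3 (λ b s z → b :* (con 1 :+ s :* z) := b :* (s :* z) :+ b) ≡.refl b (suc q) N) ⟩
    b * (suc q * N) + b ∸ b
      ≡⟨ ℕP.m+n∸n≡m _ b ⟩
    b * (suc q * N)
      ≡⟨ ≡.cong (_* (suc q * N)) aⁿ≡b ⟨
    a ^ n * (suc q * N)
      ≡⟨ solve 3 (λ c s z → c :* (s :* z) := (c :* z) :* s) ≡.refl (a ^ n) (suc q) N ⟩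
    (a ^ n * N) * suc q
      ≡⟨ ≡.cong (_* suc q) double-count ⟨
    (a * u * W) * suc q
      ≡⟨ solve 4 (λ a u w s → (a :* u :* w) :* s := w :* (a :* (u :* s))) ≡.refl a u W (suc q) ⟩
    W * (a * (u * suc q))
      ≡⟨ ≡.cong (λ z → W * (a * z)) q²∸1 ⟨
    W * (a * (q ^ 2 ∸ 1))       ∎)
    where
    q a b x : ℕ
    q = u + 1
    a = q ^ m′
    b = q ^ (n * m′)
    x = q ^ n
    aⁿ≡b : a ^ n ≡ b
    aⁿ≡b = ≡.trans (ℕP.^-*-assoc q m′ n) (≡.cong (q ^_) (ℕP.*-comm m′ n))
    split-power : q ^ (n * suc m′ + 1) ≡ b * (x * q)
    split-power = ≡.trans (≡.cong (λ e → q ^ (e + 1)) (ℕP.*-suc n m′))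
      (≡.trans (ℕP.^-distribˡ-+-* q (n + n * m′) 1)
      (≡.trans (≡.cong (_* q ^ 1) (ℕP.^-distribˡ-+-* q n (n * m′)))
      (solve 3 (λ x b q → x :* b :* (q :* con 1) := b :* (x :* q)) ≡.refl x b q)))
    q²∸1 : q ^ 2 ∸ 1 ≡ u * suc q
    q²∸1 = ≡.trans (≡.cong (_∸ 1) (solve 1 (λ u → (u :+ con 1) :^ 2 := u :* (con 1 :+ (u :+ con 1)) :+ con 1) ≡.refl u)) (ℕP.m+n∸n≡m _ 1)
    N-closed : 1 + suc q * N ≡ x * q
    N-closed = ℕP.+-cancelˡ-≡ x _ _ (begin
      x + (1 + suc q * N)
        ≡⟨ solve 3 (λ x s n → x :+ (con 1 :+ s :* n) := (x :+ con 1) :+ s :* n) ≡.refl x (suc q) N ⟩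
      (x + 1) + suc q * N
        ≡⟨ ≡.cong (_+ suc q * N) Z-closed ⟨
      suc q * Z + suc q * N
        ≡⟨ ℕP.*-distribˡ-+ (suc q) Z N ⟨
      suc q * (Z + N)
        ≡⟨ ≡.cong (suc q *_) Z+N≡qⁿ ⟩
      suc q * x
        ≡⟨ solve 2 (λ q x → (con 1 :+ q) :* x := x :+ x :* q) ≡.refl q x ⟩
      x + x * q                ∎)

module ContinuantZeros {q : ℕ} (F : FiniteField q) where
  open FiniteField F hiding (zero)
  open Matrix commRing using (K; M; m12; K-consecutive-zeros; K-∷-root)
  open Sums
  open Enumerations
  open import Data.Nat using (_^_)
  import Data.Nat.Properties as ℕP
  open import Data.Bool using (not)
  open import Data.List using (List; length; allFin)
  open import Data.List.Properties using (length-map; length-tabulate)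
  open import Data.Vec using (Vec; _∷_)
  open import Data.Product using (proj₁; proj₂)
  open import Relation.Nullary using (Dec; does; yes; no)
  open import Relation.Nullary.Decidable using (does-⇔; dec-false)
  open import Relation.Binary.Bundles using (DecSetoid)
  open import Function using (id)

  module FieldEnumeration = EnumerationViaFin setoid enum index enum-index index-enum index-cong
  open DecSetoid FieldEnumeration.decSetoid public using (_≟_)

  elementsF : List Carrier
  elementsF = Enumeration.elements FieldEnumeration.enumeration

  length-elementsF : length elementsF ≡ q
  length-elementsF = ≡.trans (length-map enum (allFin q)) (length-tabulate id)

  zeros nonzeros : ℕ → ℕ
  zeros    n = ∑ (vectors elementsF n) (λ cs → [ does (K cs ≟ 0#) ])
  nonzeros n = ∑ (vectors elementsF n) (λ cs → [ not (does (K cs ≟ 0#)) ])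

  zeros+nonzeros : ∀ n → zeros n ℕ.+ nonzeros n ≡ q ^ n
  zeros+nonzeros n = begin
    zeros n ℕ.+ nonzeros n
      ≡⟨ ∑-+ (vectors elementsF n) _ _ ⟨
    ∑ (vectors elementsF n) (λ cs → [ does (K cs ≟ 0#) ] ℕ.+ [ not (does (K cs ≟ 0#)) ])
      ≡⟨ ∑-cong (vectors elementsF n) (λ cs → [b]+[not-b] (does (K cs ≟ 0#))) ⟩
    ∑ (vectors elementsF n) (λ _ → 1)
      ≡⟨ ≡.trans (∑-const (vectors elementsF n) 1) (ℕP.*-identityʳ _) ⟩
    length (vectors elementsF n)
      ≡⟨ length-vectors elementsF n ⟩
    length elementsF ^ n
      ≡⟨ ≡.cong (_^ n) length-elementsF ⟩
    q ^ n ∎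
    where open ≡.≡-Reasoning

  zeros-zero : zeros 0 ≡ 0
  zeros-zero = ≡.cong (λ b → [ b ] ℕ.+ 0) (dec-false (1# ≟ 0#) 1≉0)

  zeros-of-affine : ∀ {n} (cs : Vec Carrier n) → ∑ elementsF (λ a → [ does (K (a ∷ cs) ≟ 0#) ]) ≡ [ not (does (K cs ≟ 0#)) ]
  zeros-of-affine cs = count (K cs ≟ 0#)
    where
    count : (d : Dec (K cs ≈ 0#)) → ∑ elementsF (λ a → [ does (K (a ∷ cs) ≟ 0#) ]) ≡ [ not (does d) ]
    count (yes k≈0) = ≡.trans
      (∑-cong elementsF (λ a → ≡.cong [_] (dec-false (K (a ∷ cs) ≟ 0#) (λ k′≈0 → 1≉0 (K-consecutive-zeros a cs k≈0 k′≈0)))))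
      (∑-zero elementsF)
    count (no k≉0) = ≡.trans
      (∑-cong elementsF (λ a → ≡.cong [_] (does-⇔ (K-∷-root cs kd≈1 a) (K (a ∷ cs) ≟ 0#) (a ≟ root))))
      (Enumeration.elements-unique FieldEnumeration.enumeration root)
      where
      d root : Carrier
      d = proj₁ (inverse (K cs) k≉0)
      root = - (m12 (M cs) * d)
      kd≈1 : K cs * d ≈ 1#
      kd≈1 = proj₂ (inverse (K cs) k≉0)

  zeros-suc : ∀ n → zeros (suc n) ≡ nonzeros n
  zeros-suc n = ≡.trans (∑-vectors-suc elementsF n _)
    (≡.trans (∑-comm elementsF (vectors elementsF n) _) (∑-cong (vectors elementsF n) zeros-of-affine))

  zeros-consecutive : ∀ n → zeros (suc n) ℕ.+ zeros n ≡ q ^ n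
  zeros-consecutive n = ≡.trans (≡.cong (ℕ._+ zeros n) (zeros-suc n)) (≡.trans (ℕP.+-comm (nonzeros n) (zeros n)) (zeros+nonzeros n))

  zeros-odd : ∀ k → suc q ℕ.* zeros (suc (2 ℕ.* k)) ≡ q ^ suc (2 ℕ.* k) ℕ.+ 1
  zeros-odd k = ≡.trans (≡.sym (ℕP.+-identityʳ _)) (≡.subst (λ b → suc q ℕ.* zeros n ℕ.+ [ b ] ≡ q ^ n ℕ.+ [ not b ])
    (Arithmetic.isEven-odd k) (Arithmetic.alternating-closed-form q zeros zeros-zero zeros-consecutive n))
    where n = suc (2 ℕ.* k)

  nonzeroElements : ℕ
  nonzeroElements = ∑ elementsF (λ c → [ not (does (c ≟ 0#)) ])

  nonzeroElements+1 : nonzeroElements ℕ.+ 1 ≡ q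
  nonzeroElements+1 = begin
    nonzeroElements ℕ.+ 1
      ≡⟨ ≡.cong (nonzeroElements ℕ.+_) (Enumeration.elements-unique FieldEnumeration.enumeration 0#) ⟨
    nonzeroElements ℕ.+ ∑ elementsF (λ c → [ does (c ≟ 0#) ])
      ≡⟨ ∑-+ elementsF _ _ ⟨
    ∑ elementsF (λ c → [ not (does (c ≟ 0#)) ] ℕ.+ [ does (c ≟ 0#) ])
      ≡⟨ ∑-cong elementsF (λ c → ≡.trans (ℕP.+-comm [ not (does (c ≟ 0#)) ] _) ([b]+[not-b] (does (c ≟ 0#)))) ⟩
    ∑ elementsF (λ _ → 1)
      ≡⟨ ≡.trans (∑-const elementsF 1) (ℕP.*-identityʳ _) ⟩
    length elementsF
      ≡⟨ length-elementsF ⟩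
    q ∎
    where open ≡.≡-Reasoning

module TruncatedRingEnumeration {q : ℕ} (F : FiniteField q) (m : ℕ) where
  open FiniteField F hiding (zero)
  open Trunc F m using (A; eqA; allA; allVecs)
  open TruncatedPolynomialRing F m using (_≈A_; ringA)
  open Sums
  open Enumerations
  open ContinuantZeros F using (module FieldEnumeration)
  open import Data.Bool using (Bool; T)
  open import Data.List using (List; _∷_; map; allFin; concatMap)
  open import Data.List.Relation.Unary.All as All using ()
  open import Data.List.Relation.Unary.All.Properties using (all⁺; all⁻)
  open import Data.List.Membership.Propositional.Properties using (∈-allFin)
  open import Data.Vec using (Vec; _∷_; lookup; tabulate)
  open import Data.Vec.Properties using (lookup∘tabulate; tabulate∘lookup)
  open import Data.Fin using (Fin)
  import Data.Fin.Properties as Fin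
  open import Relation.Nullary using (Dec; does)
  open import Relation.Nullary.Decidable using (T?; ⌊_⌋; map′; toWitness; fromWitness; does-⇔)
  open import Relation.Binary.Bundles using (DecSetoid)
  open import Function using (_⇔_; mk⇔)

  allVecs≡vectors : {X : Set} (xs : List X) (k : ℕ) → allVecs xs k ≡ vectors xs k
  allVecs≡vectors xs zero    = ≡.refl
  allVecs≡vectors xs (suc k) = ≡.cong (λ vs → concatMap (λ x → map (x ∷_) vs) xs) (allVecs≡vectors xs k)

  coordinatesEqual : A → A → Fin m → Bool
  coordinatesEqual x y i = ⌊ index (x i) Fin.≟ index (y i) ⌋

  eqA-sound : ∀ {x y} → T (eqA x y) → x ≈A y
  eqA-sound {x} {y} t i =
    FieldEnumeration.index-injective (toWitness (All.lookup (all⁺ (coordinatesEqual x y) (allFin m) t) (∈-allFin i)))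

  eqA-complete : ∀ {x y} → x ≈A y → T (eqA x y)
  eqA-complete {x} {y} x≈y = all⁻ (coordinatesEqual x y) {allFin m} (All.tabulate (λ {i} _ → fromWitness (index-cong (x≈y i))))

  A-decSetoid : DecSetoid 0ℓ 0ℓ
  A-decSetoid = record
    { isDecEquivalence = record
      { isEquivalence = CommutativeRing.isEquivalence ringA
      ; _≟_ = λ x y → map′ eqA-sound eqA-complete (T? (eqA x y)) } }

  decode : Vec (Fin q) m → A
  decode v i = enum (lookup v i)

  encode : A → Vec (Fin q) m
  encode t = tabulate (λ i → index (t i))

  decode≈⇔≡encode : ∀ c t → decode c ≈A t ⇔ Pointwise.Pointwise _≡_ c (encode t)
  decode≈⇔≡encode c t = mk⇔
    (λ e → ≡.subst (λ v → Pointwise.Pointwise _≡_ v (encode t)) (tabulate∘lookup c)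
             (Pointwise.tabulate⁺ (λ i → ≡.trans (≡.sym (index-enum (lookup c i))) (index-cong (e i)))))
    (λ r i → trans (reflexive (≡.cong enum (≡.trans (Pointwise.lookup r i) (lookup∘tabulate _ i)))) (enum-index (t i)))

  A-enumeration : Enumeration A-decSetoid
  A-enumeration = record { elements = allA ; elements-unique = unique }
    where
    open DecSetoid A-decSetoid using (_≟_)
    unique : ∀ t → ∑ allA (λ x → [ does (x ≟ t) ]) ≡ 1
    unique t = begin
      ∑ allA (λ x → [ does (x ≟ t) ])
        ≡⟨ ∑-map decode (allVecs (allFin q) m) _ ⟩
      ∑ (allVecs (allFin q) m) (λ c → [ does (decode c ≟ t) ])
        ≡⟨ ≡.cong (λ vs → ∑ vs (λ c → [ does (decode c ≟ t) ])) (allVecs≡vectors (allFin q) m) ⟩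
      ∑ (vectors (allFin q) m) (λ c → [ does (decode c ≟ t) ])
        ≡⟨ ∑-cong (vectors (allFin q) m) (λ c → ≡.cong [_] (does-⇔ (decode≈⇔≡encode c t) (decode c ≟ t) (c ≋? encode t))) ⟩
      ∑ (vectors (allFin q) m) (λ c → [ does (c ≋? encode t) ])
        ≡⟨ Enumeration.elements-unique (vecEnumeration (finEnumeration q) m) (encode t) ⟩
      1 ∎
      where
      open ≡.≡-Reasoning
      _≋?_ : ∀ {n} (v w : Vec (Fin q) n) → Dec (Pointwise.Pointwise _≡_ v w)
      _≋?_ = Pointwise.decidable Fin._≟_

module ContinuantCounting {q : ℕ} (F : FiniteField q) (m′ : ℕ) where
  open FiniteField F hiding (zero)
  module T = Trunc F (suc m′)
  open T using (A; allA; 1A; 0A; -A_; _*A_)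
  open TruncatedPolynomialRing F (suc m′) using (ringA)
  open TruncatedPolynomialUnits F m′ using (constantTerm; constantTerm-isRingHomomorphism; constantTerm≉0⇒invertible)
  open TruncatedRingEnumeration F (suc m′) using (A-decSetoid; A-enumeration; allVecs≡vectors; decode)
  open ContinuantZeros F using (elementsF; nonzeros; nonzeroElements) renaming (_≟_ to _≟F_)
  open Sums
  open Enumerations
  module RA = CommutativeRing ringA
  module MA = Matrix ringA
  open MA using (K; _≈M_; meq)
  open import Data.Nat using (_^_)
  import Data.Nat.Properties as ℕP
  open import Data.Bool using (Bool; not; _∧_)
  open import Data.List using (length; allFin)
  open import Data.List.Properties using (length-tabulate)
  open import Data.Vec as Vec using (Vec; []; _∷_; _++_)
  open import Data.Fin using () renaming (zero to fzero)
  open import Data.Product using (proj₁; proj₂)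
  open import Function using (id; _⇔_; mk⇔)
  open import Relation.Nullary using (Dec; does; yes; no; ¬_)
  open import Relation.Nullary.Decidable using (map′; _×-dec_; does-⇔)
  open import Relation.Binary.Bundles using (DecSetoid)
  open DecSetoid A-decSetoid using () renaming (_≟_ to _≟A_)
  module AP = EnumerationProperties A-enumeration

  countK : ∀ n → A → ℕ
  countK n t = ∑ (vectors allA n) (λ u → [ does (K u ≟A t) ])

  toMat : T.Mat → MA.Mat
  toMat (T.mat a b c d) = MA.mat a b c d

  toMat-Mgo : ∀ {n} X (as : Vec A n) → toMat (T.Mgo X as) ≡ MA.Mgo (toMat X) as
  toMat-Mgo X []       = ≡.refl
  toMat-Mgo X (a ∷ as) = toMat-Mgo (T.E a T.· X) as

  ≈idMat? : ∀ X → Dec (X ≈M MA.idMat)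
  ≈idMat? (MA.mat a b c d) = map′ (λ (e11 , e12 , e21 , e22) → meq e11 e12 e21 e22) (λ (meq e11 e12 e21 e22) → e11 , e12 , e21 , e22)
    ((a ≟A 1A) ×-dec ((b ≟A 0A) ×-dec ((c ≟A 0A) ×-dec (d ≟A 1A))))

  isId≡does : ∀ X → T.isId X ≡ does (≈idMat? (toMat X))
  isId≡does (T.mat a b c d) = ≡.refl

  last-two-letters : ∀ {n} (u : Vec A n) → ∑ allA (λ b → ∑ allA (λ c → [ T.isId (T.M (u ++ b ∷ c ∷ [])) ])) ≡ [ does (K u ≟A -A 1A) ]
  last-two-letters u = ≡.trans (∑-cong allA (λ b → ∑-cong allA (λ c → ≡.cong [_] (criterion b c))))
    (AP.∑-∑-unique (-A MA.m21 (MA.M u)) (MA.m12 (MA.M u)) (does (K u ≟A -A 1A)))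
    where
    criterion : ∀ b c → T.isId (T.M (u ++ b ∷ c ∷ [])) ≡ does (b ≟A -A MA.m21 (MA.M u)) ∧ (does (c ≟A MA.m12 (MA.M u)) ∧ does (K u ≟A -A 1A))
    criterion b c = begin
      T.isId (T.M (u ++ b ∷ c ∷ []))
        ≡⟨ isId≡does (T.M (u ++ b ∷ c ∷ [])) ⟩
      does (≈idMat? (toMat (T.M (u ++ b ∷ c ∷ []))))
        ≡⟨ ≡.cong (λ X → does (≈idMat? X)) (≡.trans (toMat-Mgo T.idMat (u ++ b ∷ c ∷ [])) (MA.Mgo-++ MA.idMat u (b ∷ c ∷ []))) ⟩
      does (≈idMat? (MA.E c MA.· (MA.E b MA.· MA.M u)))
        ≡⟨ does-⇔ (MA.E·E·≈id⇔ b c (MA.M u) (MA.det-M u)) (≈idMat? _) ((b ≟A _) ×-dec ((c ≟A _) ×-dec (K u ≟A -A 1A))) ⟩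
      does (b ≟A -A MA.m21 (MA.M u)) ∧ (does (c ≟A MA.m12 (MA.M u)) ∧ does (K u ≟A -A 1A)) ∎
      where open ≡.≡-Reasoning

  w1≡countK : ∀ n → T.w1 (n ℕ.+ 2) ≡ countK n (-A 1A)
  w1≡countK n = begin
    T.w1 (n ℕ.+ 2)
      ≡⟨ length-filterᵇ _ (T.allVecs allA (n ℕ.+ 2)) ⟩
    ∑ (T.allVecs allA (n ℕ.+ 2)) (λ as → [ T.isId (T.M as) ])
      ≡⟨ ≡.cong (λ vs → ∑ vs (λ as → [ T.isId (T.M as) ])) (allVecs≡vectors allA (n ℕ.+ 2)) ⟩
    ∑ (vectors allA (n ℕ.+ 2)) (λ as → [ T.isId (T.M as) ])
      ≡⟨ ∑-vectors-+ allA n 2 _ ⟩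
    ∑ (vectors allA n) (λ u → ∑ (vectors allA 2) (λ w → [ T.isId (T.M (u ++ w)) ]))
      ≡⟨ ∑-cong (vectors allA n) (λ u → ≡.trans (∑-vectors-2 allA _) (last-two-letters u)) ⟩
    countK n (-A 1A) ∎
    where open ≡.≡-Reasoning

  countK-unit-invariant : ∀ k t → ¬ constantTerm t ≈ 0# → countK (suc (2 ℕ.* k)) t ≡ countK (suc (2 ℕ.* k)) (-A 1A)
  countK-unit-invariant k t t₀≉0 = begin
    countK n t
      ≡⟨ Vₙ.∑-bijection σ τ MA.alternate-cong MA.alternate-cong (MA.alternate-inverse uv≈1 vu≈1)
           (MA.alternate-inverse vu≈1 uv≈1) (λ bs → [ does (K bs ≟A t) ]) K≈t-respects ⟨
    ∑ (vectors allA n) (λ bs → [ does (K (σ bs) ≟A t) ])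
      ≡⟨ ∑-cong (vectors allA n) (λ bs → ≡.cong [_] (does-⇔ (scaled⇔ bs) (K (σ bs) ≟A t) (K bs ≟A -A 1A))) ⟩
    countK n (-A 1A) ∎
    where
    open ≡.≡-Reasoning
    open CommutativeRingSolver ringA
    n : ℕ
    n = suc (2 ℕ.* k)
    module Vₙ = EnumerationProperties (vecEnumeration A-enumeration n)
    u v : A
    u = -A t
    u₀≉0 : ¬ constantTerm u ≈ 0#
    u₀≉0 u₀≈0 = t₀≉0 (-‿injective (trans u₀≈0 (sym -0#≈0#)))
      where open import Algebra.Properties.Ring ring using (-‿injective; -0#≈0#)
    v = proj₁ (constantTerm≉0⇒invertible u u₀≉0)
    uv≈1 : u *A v RA.≈ 1A
    uv≈1 = proj₂ (constantTerm≉0⇒invertible u u₀≉0)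
    vu≈1 : v *A u RA.≈ 1A
    vu≈1 = RA.trans (RA.*-comm v u) uv≈1
    σ τ : Vec A n → Vec A n
    σ = MA.alternate u v
    τ = MA.alternate v u
    K≈t-respects : Vₙ.Respects≈ (λ bs → [ does (K bs ≟A t) ])
    K≈t-respects {bs} {cs} r = ≡.cong [_] (does-⇔ (mk⇔ (RA.trans (RA.sym (MA.K-cong r))) (RA.trans (MA.K-cong r))) (K bs ≟A t) (K cs ≟A t))
    scaled⇔ : ∀ bs → K (σ bs) RA.≈ t ⇔ K bs RA.≈ -A 1A
    scaled⇔ bs = mk⇔
      (λ e → RA.trans (RA.sym (RA.trans (RA.sym (RA.*-assoc v u (K bs))) (RA.trans (RA.*-congʳ vu≈1) (RA.*-identityˡ _))))
               (RA.trans (RA.*-congˡ (RA.trans (RA.sym Kσ≈uK) e))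
               (RA.trans (solve 2 (λ v t → v :* t := :- (v :* (:- t))) RA.refl v t) (RA.-‿cong vu≈1))))
      (λ e → RA.trans Kσ≈uK (RA.trans (RA.*-congˡ e) (solve 1 (λ t → (:- t) :* (:- :1) := t) RA.refl t)))
      where
      Kσ≈uK : K (σ bs) RA.≈ u *A K bs
      Kσ≈uK = MA.K-alternate-odd uv≈1 k bs

  ∑-constantTerm : ∀ (h : Carrier → ℕ) → ∑ allA (λ a → h (constantTerm a)) ≡ q ^ m′ ℕ.* ∑ elementsF h
  ∑-constantTerm h = begin
    ∑ allA (λ a → h (constantTerm a))
      ≡⟨ ∑-map decode (T.allVecs (allFin q) (suc m′)) _ ⟩
    ∑ (T.allVecs (allFin q) (suc m′)) (λ c → h (constantTerm (decode c)))
      ≡⟨ ≡.cong (λ vs → ∑ vs (λ c → h (constantTerm (decode c)))) (allVecs≡vectors (allFin q) (suc m′)) ⟩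
    ∑ (vectors (allFin q) (suc m′)) (λ c → h (constantTerm (decode c)))
      ≡⟨ ∑-vectors-suc (allFin q) m′ _ ⟩
    ∑ (allFin q) (λ i → ∑ (vectors (allFin q) m′) (λ _ → h (enum i)))
      ≡⟨ ∑-cong (allFin q) (λ i → ∑-const (vectors (allFin q) m′) (h (enum i))) ⟩
    ∑ (allFin q) (λ i → length (vectors (allFin q) m′) ℕ.* h (enum i))
      ≡⟨ ∑-cong (allFin q) (λ i → ≡.cong (ℕ._* h (enum i)) length≡) ⟩
    ∑ (allFin q) (λ i → q ^ m′ ℕ.* h (enum i))
      ≡⟨ ∑-*ˡ (allFin q) (q ^ m′) (λ i → h (enum i)) ⟩
    q ^ m′ ℕ.* ∑ (allFin q) (λ i → h (enum i))
      ≡⟨ ≡.cong (q ^ m′ ℕ.*_) (∑-map enum (allFin q) h) ⟨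
    q ^ m′ ℕ.* ∑ elementsF h ∎
    where
    open ≡.≡-Reasoning
    length≡ : length (vectors (allFin q) m′) ≡ q ^ m′
    length≡ = ≡.trans (length-vectors (allFin q) m′) (≡.cong (_^ m′) (length-tabulate id))

  ∑-vectors-constantTerm : ∀ n (H : Vec Carrier n → ℕ) →
    ∑ (vectors allA n) (λ bs → H (Vec.map constantTerm bs)) ≡ (q ^ m′) ^ n ℕ.* ∑ (vectors elementsF n) H
  ∑-vectors-constantTerm zero    H = ≡.sym (ℕP.+-identityʳ _)
  ∑-vectors-constantTerm (suc n) H = begin
    ∑ (vectors allA (suc n)) (λ bs → H (Vec.map constantTerm bs))
      ≡⟨ ∑-vectors-suc allA n _ ⟩
    ∑ allA (λ a → ∑ (vectors allA n) (λ bs → H (constantTerm a ∷ Vec.map constantTerm bs)))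
                                                                                ≡⟨ ∑-cong allA (λ a → ∑-vectors-constantTerm n (λ cs → H (constantTerm a ∷ cs))) ⟩
    ∑ allA (λ a → Q ^ n ℕ.* G (constantTerm a))
      ≡⟨ ∑-*ˡ allA (Q ^ n) (λ a → G (constantTerm a)) ⟩
    Q ^ n ℕ.* ∑ allA (λ a → G (constantTerm a))
      ≡⟨ ≡.cong (Q ^ n ℕ.*_) (∑-constantTerm G) ⟩
    Q ^ n ℕ.* (Q ℕ.* ∑ elementsF G)
      ≡⟨ ≡.sym (ℕP.*-assoc (Q ^ n) Q _) ⟩
    Q ^ n ℕ.* Q ℕ.* ∑ elementsF G
      ≡⟨ ≡.cong (ℕ._* ∑ elementsF G) (ℕP.*-comm (Q ^ n) Q) ⟩
    Q ^ suc n ℕ.* ∑ elementsF G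
      ≡⟨ ≡.cong (Q ^ suc n ℕ.*_) (∑-vectors-suc elementsF n H) ⟨
    Q ^ suc n ℕ.* ∑ (vectors elementsF (suc n)) H ∎
    where
    open ≡.≡-Reasoning
    Q : ℕ
    Q = q ^ m′
    G : Carrier → ℕ
    G c = ∑ (vectors elementsF n) (λ cs → H (c ∷ cs))

  isUnit : A → Bool
  isUnit t = not (does (constantTerm t ≟F 0#))

  unitContinuants : ℕ → ℕ
  unitContinuants n = ∑ (vectors allA n) (λ bs → [ isUnit (K bs) ])

  unitContinuants-by-reduction : ∀ n → unitContinuants n ≡ (q ^ m′) ^ n ℕ.* nonzeros n
  unitContinuants-by-reduction n = ≡.trans
    (∑-cong (vectors allA n) (λ bs → ≡.cong (λ b → [ not b ]) (does-⇔ (reduce bs) (constantTerm (K bs) ≟F 0#) (MF.K (Vec.map constantTerm bs) ≟F 0#))))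
    (∑-vectors-constantTerm n (λ cs → [ not (does (MF.K cs ≟F 0#)) ]))
    where
    module MF = Matrix commRing
    open MatrixHomomorphism ringA commRing constantTerm constantTerm-isRingHomomorphism using (K-homo)
    reduce : ∀ bs → constantTerm (K bs) ≈ 0# ⇔ MF.K (Vec.map constantTerm bs) ≈ 0#
    reduce bs = mk⇔ (trans (sym (K-homo bs))) (trans (K-homo bs))

  unitContinuants-by-fibres : ∀ k → unitContinuants (suc (2 ℕ.* k)) ≡ q ^ m′ ℕ.* nonzeroElements ℕ.* countK (suc (2 ℕ.* k)) (-A 1A)
  unitContinuants-by-fibres k = begin
    unitContinuants n
      ≡⟨ AP.∑-fibres (vectors allA n) K (λ t → [ isUnit t ]) isUnit-respects ⟩
    ∑ allA (λ t → [ isUnit t ] ℕ.* countK n t)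
      ≡⟨ ∑-cong allA units-only ⟩
    ∑ allA (λ t → [ isUnit t ] ℕ.* countK n (-A 1A))
      ≡⟨ ∑-*ʳ allA (countK n (-A 1A)) (λ t → [ isUnit t ]) ⟩
    ∑ allA (λ t → [ isUnit t ]) ℕ.* countK n (-A 1A)
      ≡⟨ ≡.cong (ℕ._* countK n (-A 1A)) (∑-constantTerm (λ c → [ not (does (c ≟F 0#)) ])) ⟩
    q ^ m′ ℕ.* nonzeroElements ℕ.* countK n (-A 1A) ∎
    where
    open ≡.≡-Reasoning
    n : ℕ
    n = suc (2 ℕ.* k)
    isUnit-respects : AP.Respects≈ (λ t → [ isUnit t ])
    isUnit-respects {s} {t} s≈t = ≡.cong (λ b → [ not b ])
      (does-⇔ (mk⇔ (trans (sym (s≈t fzero))) (trans (s≈t fzero))) (constantTerm s ≟F 0#) (constantTerm t ≟F 0#))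
    units-only : ∀ t → [ isUnit t ] ℕ.* countK n t ≡ [ isUnit t ] ℕ.* countK n (-A 1A)
    units-only t = by-cases (constantTerm t ≟F 0#)
      where
      by-cases : (d : Dec (constantTerm t ≈ 0#)) → [ not (does d) ] ℕ.* countK n t ≡ [ not (does d) ] ℕ.* countK n (-A 1A)
      by-cases (yes _)    = ≡.refl
      by-cases (no t₀≉0) = ≡.cong (1 ℕ.*_) (countK-unit-invariant k t t₀≉0)

open import Data.Nat using (_+_; _*_; _∸_; _^_; _≤_; s≤s; z≤n)

corollary2p16 : (q : ℕ) → IsPrimePower q → (F : FiniteField q) →
    (m : ℕ) → 1 ≤ m → (n : ℕ) → Odd n →
    Trunc.w1 F m (n + 2) * (q ^ (m ∸ 1) * (q ^ 2 ∸ 1))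
      ≡ q ^ (n * m + 1) ∸ q ^ (n * (m ∸ 1))
corollary2p16 q _ F (suc m′) (s≤s z≤n) .(suc (2 * k)) (k , ≡.refl) = begin
  Trunc.w1 F (suc m′) (n + 2) * (q ^ m′ * (q ^ 2 ∸ 1))  ≡⟨ ≡.cong (_* (q ^ m′ * (q ^ 2 ∸ 1))) (w1≡countK n) ⟩
  countK n (-A 1A) * (q ^ m′ * (q ^ 2 ∸ 1))              ≡⟨ Arithmetic.final-formula q m′ n (countK n (-A 1A)) nonzeroElements
                                                               (zeros n) (nonzeros n) nonzeroElements+1 double-count
                                                               (zeros+nonzeros n) (zeros-odd k) ⟩
  q ^ (n * suc m′ + 1) ∸ q ^ (n * m′)                    ∎
  where
  open ≡.≡-Reasoning
  open ContinuantCounting F m′ using (countK; w1≡countK; unitContinuants-by-fibres; unitContinuants-by-reduction)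
  open ContinuantZeros F using (zeros; nonzeros; nonzeroElements; nonzeroElements+1; zeros+nonzeros; zeros-odd)
  open Trunc F (suc m′) using (-A_; 1A)
  n : ℕ
  n = suc (2 * k)
  double-count : q ^ m′ * nonzeroElements * countK n (-A 1A) ≡ (q ^ m′) ^ n * nonzeros n
  double-count = ≡.trans (≡.sym (unitContinuants-by-fibres k)) (unitContinuants-by-reduction n)
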